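{- Let $G$ be a graph, and for each $v\in V(G)$ let $p(v)\geq 1$ be an integer. Let $\mathcal{H}=\{K_{p(v)}: v\in V(G)\}$ and $p=\min_{v\in V(G)} p(v)$. If $p\geq \frac{n(G)^2}{4(n(G)+1)}$, then the independence polynomial $I(G\circ\mathcal{H};x)$ is log-concave.
   Context: All graphs are finite, simple, undirected and loopless; $n(G)$ is the number of vertices. $K_m$ denotes the complete graph on $m$ vertices. For a family $\mathcal{H}=\{H_v: v\in V(G)\}$ of non-empty graphs indexed by $V(G)$, the corona $G\circ\mathcal{H}$ is the disjoint union of $G$ and all the $H_v$, together with edges joining each $v\in V(G)$ to all vertices of $H_v$. An independent set is a set of pairwise non-adjacent vertices; $\alpha(G)$ is the maximum size of an independent set. The independence polynomial is $I(G;x)=\sum_{k=0}^{\alpha(G)} s_k x^k$, where $s_k$ is the number of independent sets of size $k$ in $G$; it is log-concave if $s_k^2\geq s_{k-1}s_{k+1}$ for all $1\le k\le \alpha(G)-1$. -}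

module Defs where

open import Data.Bool using (Bool; true; false; _∧_; _∨_; not; if_then_else_)
open import Data.Nat using (ℕ; zero; suc; _+_; _*_; _⊔_; _≡ᵇ_; _≤_; _∸_)
open import Data.Fin using (Fin; toℕ)
open import Data.Fin.Properties using () renaming (_≟_ to _≟ᶠ_)
open import Data.List using (List; []; _∷_; _++_; map; concatMap; length; foldr)
open import Data.List using (allFin)
open import Data.Product using (Σ; _,_)
open import Data.Sum using (_⊎_; inj₁; inj₂)
open import Relation.Nullary.Decidable using (⌊_⌋)
open import Relation.Binary.PropositionalEquality using (_≡_)

record Graph (n : ℕ) : Set where
  field
    adj    : Fin n → Fin n → Bool
    sym    : ∀ u v → adj u v ≡ adj v u
    irrefl : ∀ v → adj v v ≡ false
open Graph public

-- A finite graph presented by a duplicate-free list of all its vertices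
-- together with a (symmetric, loopless) Boolean adjacency.
record FinGraph : Set₁ where
  field
    V     : Set
    verts : List V
    adjF  : V → V → Bool
open FinGraph public

sublists : {A : Set} → List A → List (List A)
sublists []       = [] ∷ []
sublists (x ∷ xs) = let r = sublists xs in r ++ map (x ∷_) r

allᵇ : {A : Set} → (A → Bool) → List A → Bool
allᵇ p []       = true
allᵇ p (x ∷ xs) = p x ∧ allᵇ p xs

independentᵇ : {A : Set} → (A → A → Bool) → List A → Bool
independentᵇ adj []       = true
independentᵇ adj (x ∷ xs) = allᵇ (λ y → not (adj x y)) xs ∧ independentᵇ adj xs

filterᵇ : {A : Set} → (A → Bool) → List A → List A
filterᵇ p []       = []
filterᵇ p (x ∷ xs) = if p x then x ∷ filterᵇ p xs else filterᵇ p xs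

independentSets : (H : FinGraph) → List (List (V H))
independentSets H = filterᵇ (independentᵇ (adjF H)) (sublists (verts H))

indepCount : FinGraph → ℕ → ℕ
indepCount H k = length (filterᵇ (λ S → length S ≡ᵇ k) (independentSets H))

α : FinGraph → ℕ
α H = foldr _⊔_ 0 (map length (independentSets H))

LogConcave : FinGraph → Set
LogConcave H = ∀ k → 1 ≤ k → k + 1 ≤ α H →
  indepCount H (k ∸ 1) * indepCount H (k + 1) ≤ indepCount H k * indepCount H k

-- Corona G ∘ {K_{p(v)}} : vertices of G plus, for each v, a clique of size p(v)
-- whose vertices are all joined to v.
_==ᶠ_ : {n : ℕ} → Fin n → Fin n → Bool
u ==ᶠ v = ⌊ u ≟ᶠ v ⌋

coronaK : {n : ℕ} → Graph n → (p : Fin n → ℕ) → FinGraph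
coronaK {n} G p = record
  { V     = Fin n ⊎ Σ (Fin n) (λ v → Fin (p v))
  ; verts = map inj₁ (allFin n)
            ++ concatMap (λ v → map (λ i → inj₂ (v , i)) (allFin (p v))) (allFin n)
  ; adjF  = a
  }
  where
  a : Fin n ⊎ Σ (Fin n) (λ v → Fin (p v)) → Fin n ⊎ Σ (Fin n) (λ v → Fin (p v)) → Bool
  a (inj₁ u)       (inj₁ v)       = adj G u v
  a (inj₁ u)       (inj₂ (v , j)) = u ==ᶠ v
  a (inj₂ (u , i)) (inj₁ v)       = u ==ᶠ v
  a (inj₂ (u , i)) (inj₂ (v , j)) = (u ==ᶠ v) ∧ not (toℕ i ≡ᵇ toℕ j)

{-# OPTIONS --safe #-}
-- An independent set of G ∘ {K_{p v}} is determined by its set S of hubs, an independent set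
-- of G, and the set U ⊇ S of vertices v whose block {v} ∪ K_{p v} it meets. Hence the k-th
-- coefficient of I(G ∘ H; x) is s_k = Σ_{|U| = k} σ(U), where
-- σ(U) = Σ_{S ⊆ U independent} Π_{v ∈ U ∖ S} p v (coronaCoeff and touchCount), and adding a
-- vertex d to U multiplies σ by a factor between p d and 1 + p d. An exchange argument turns
-- these local bounds into
--   e_{k+1} s_k ≤ e_k s_{k+1}   and   q s_{k+1} e_k ≤ (1 + q) s_k e_{k+1},
-- where e_k are the elementary symmetric polynomials of the p v and q = min p. With Newton's
-- inequality (k+2)(m+2) e_k e_{k+2} ≤ (k+1)(m+1) e_{k+1}², where n = k + m + 2, this gives
-- q (k+2)(m+2) s_k s_{k+2} ≤ (1 + q)(k+1)(m+1) s_{k+1}², and (1 + q)(k+1)(m+1) ≤ q (k+2)(m+2)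
-- follows from 4 (k+1)(m+1) ≤ n² ≤ 4 (n+1) q.
module Submission where

open import Defs hiding (sym)
open import Algebra.Bundles using (CommutativeMonoid)
import Algebra.Properties.CommutativeSemigroup as CommSemigroupProperties
open import Data.Bool using (Bool; true; false; _∧_; _∨_; not; if_then_else_; T)
open import Data.Bool.Properties
  using (T-∧; ∧-zeroʳ; ∧-identityʳ; ∨-identityʳ; ∧-assoc; ∧-comm; ∧-commutativeMonoid)
open import Data.Empty using (⊥-elim)
open import Data.Fin using (Fin; zero; suc; toℕ)
import Data.Fin.Properties as Finₚ
open import Data.Fin.Subset using (Subset; ∣_∣; _∩_; _─_)
open import Data.Fin.Subset.Properties using (∣p∣≤n; ∣p∩q∣≤∣p∣; ∣p∩q∣≤∣q∣; ∩-comm)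
open import Data.List using (List; []; _∷_; _++_; map; length; tabulate; concat; allFin)
open import Data.List.Extrema.Nat using (argmin; f[argmin]≤f[xs])
open import Data.List.Membership.Propositional.Properties using (∈-allFin)
open import Data.List.Properties using (map-tabulate; tabulate-cong)
import Data.List.Relation.Unary.All as All
open import Data.Nat
open import Data.Nat.Properties
open import Data.Nat.Tactic.RingSolver using (solve-∀)
open import Data.Product using (Σ; _×_; _,_; proj₁; proj₂)
open import Data.Sum using (_⊎_; inj₁; inj₂)
open import Data.Vec using ([]; _∷_; lookup; _[_]≔_)
open import Data.Vec.Properties using ([]≔-idempotent; []≔-lookup; lookup∘update)
open import Function using (_∘_; Equivalence)
open import Relation.Binary.PropositionalEquality
open import Relation.Nullary using (yes; no; contradiction)
open import Algebra.Properties.Semiring.Sum +-*-semiring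
  using (sum-syntax; sum-cong-≗; sum-replicate-zero; *-distribˡ-sum; *-distribʳ-sum)

module *-CS = CommSemigroupProperties *-commutativeSemigroup
module +-CS = CommSemigroupProperties +-commutativeSemigroup
module ∧-CS = CommSemigroupProperties (CommutativeMonoid.commutativeSemigroup ∧-commutativeMonoid)

-- Sums over subsets

𝟙 : Bool → ℕ
𝟙 true  = 1
𝟙 false = 0

𝟙-∧ : ∀ a b → 𝟙 (a ∧ b) ≡ 𝟙 a * 𝟙 b
𝟙-∧ true  b = sym (*-identityˡ (𝟙 b))
𝟙-∧ false b = refl

𝟙-not : ∀ b → 𝟙 (not b) + 𝟙 b ≡ 1
𝟙-not true  = refl
𝟙-not false = refl

𝟙-∧-* : ∀ a b z → 𝟙 (a ∧ b) * z ≡ 𝟙 a * (𝟙 b * z)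
𝟙-∧-* a b z = trans (cong (_* z) (𝟙-∧ a b)) (*-assoc (𝟙 a) (𝟙 b) z)

𝟙-*-cong : ∀ b {x y} z → (T b → x ≡ y) → x * (𝟙 b * z) ≡ y * (𝟙 b * z)
𝟙-*-cong true  z x≡y = cong (λ x → x * (1 * z)) (x≡y _)
𝟙-*-cong false {x} {y} z _ = trans (*-zeroʳ x) (sym (*-zeroʳ y))

𝟙-mono-≤ : ∀ {a b} → (T a → T b) → 𝟙 a ≤ 𝟙 b
𝟙-mono-≤ {false}         _   = z≤n
𝟙-mono-≤ {true}  {true}  _   = ≤-refl
𝟙-mono-≤ {true}  {false} a⇒b = ⊥-elim (a⇒b _)

∑⊆ : ∀ n → (Subset n → ℕ) → ℕ
∑⊆ zero    f = f []
∑⊆ (suc n) f = ∑⊆ n (f ∘ (false ∷_)) + ∑⊆ n (f ∘ (true ∷_))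

infixl 10 ∑⊆
syntax ∑⊆ n (λ U → e) = ∑[ U ⊆ n ] e

∑⊆-cong : ∀ {n} {f g : Subset n → ℕ} → (∀ U → f U ≡ g U) → ∑⊆ n f ≡ ∑⊆ n g
∑⊆-cong {zero}  f≗g = f≗g []
∑⊆-cong {suc n} f≗g = cong₂ _+_ (∑⊆-cong (f≗g ∘ (false ∷_))) (∑⊆-cong (f≗g ∘ (true ∷_)))

∑⊆-mono-≤ : ∀ {n} {f g : Subset n → ℕ} → (∀ U → f U ≤ g U) → ∑⊆ n f ≤ ∑⊆ n g
∑⊆-mono-≤ {zero}  f≤g = f≤g []
∑⊆-mono-≤ {suc n} f≤g = +-mono-≤ (∑⊆-mono-≤ (f≤g ∘ (false ∷_))) (∑⊆-mono-≤ (f≤g ∘ (true ∷_)))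

∑⊆-zero : ∀ n → ∑[ U ⊆ n ] 0 ≡ 0
∑⊆-zero zero    = refl
∑⊆-zero (suc n) = cong₂ _+_ (∑⊆-zero n) (∑⊆-zero n)

∑⊆-distrib-+ : ∀ {n} (f g : Subset n → ℕ) → ∑[ U ⊆ n ] (f U + g U) ≡ ∑⊆ n f + ∑⊆ n g
∑⊆-distrib-+ {zero}  f g = refl
∑⊆-distrib-+ {suc n} f g =
  trans (cong₂ _+_ (∑⊆-distrib-+ f₀ g₀) (∑⊆-distrib-+ f₁ g₁))
        (+-CS.interchange (∑⊆ n f₀) (∑⊆ n g₀) (∑⊆ n f₁) (∑⊆ n g₁))
  where
  f₀ f₁ g₀ g₁ : Subset n → ℕ
  f₀ = f ∘ (false ∷_)
  f₁ = f ∘ (true ∷_)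
  g₀ = g ∘ (false ∷_)
  g₁ = g ∘ (true ∷_)

*-distribˡ-∑⊆ : ∀ {n} c (f : Subset n → ℕ) → c * ∑⊆ n f ≡ ∑[ U ⊆ n ] (c * f U)
*-distribˡ-∑⊆ {zero}  c f = refl
*-distribˡ-∑⊆ {suc n} c f =
  trans (*-distribˡ-+ c _ _) (cong₂ _+_ (*-distribˡ-∑⊆ c (f ∘ (false ∷_))) (*-distribˡ-∑⊆ c (f ∘ (true ∷_))))

*-distribʳ-∑⊆ : ∀ {n} c (f : Subset n → ℕ) → ∑⊆ n f * c ≡ ∑[ U ⊆ n ] (f U * c)
*-distribʳ-∑⊆ c f = trans (*-comm _ c) (trans (*-distribˡ-∑⊆ c f) (∑⊆-cong (λ U → *-comm c (f U))))

∑⊆-comm : ∀ {m n} (f : Subset m → Subset n → ℕ) →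
  ∑[ A ⊆ m ] ∑[ B ⊆ n ] f A B ≡ ∑[ B ⊆ n ] ∑[ A ⊆ m ] f A B
∑⊆-comm {zero}  f = refl
∑⊆-comm {suc m} f = trans (cong₂ _+_ (∑⊆-comm (f ∘ (false ∷_))) (∑⊆-comm (f ∘ (true ∷_))))
  (sym (∑⊆-distrib-+ (λ B → ∑[ A ⊆ m ] f (false ∷ A) B) (λ B → ∑[ A ⊆ m ] f (true ∷ A) B)))

∑⊆-∑-comm : ∀ {n m} (f : Subset n → Fin m → ℕ) →
  ∑[ U ⊆ n ] ∑[ i < m ] f U i ≡ ∑[ i < m ] ∑[ U ⊆ n ] f U i
∑⊆-∑-comm {n} {zero}  f = ∑⊆-zero n
∑⊆-∑-comm {n} {suc m} f =
  trans (∑⊆-distrib-+ (λ U → f U zero) (λ U → ∑[ i < m ] f U (suc i)))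
        (cong (∑⊆ n (λ U → f U zero) +_) (∑⊆-∑-comm (λ U → f U ∘ suc)))

∑⊆-product : ∀ {m n} (f : Subset m → ℕ) (g : Subset n → ℕ) →
  ∑⊆ m f * ∑⊆ n g ≡ ∑[ A ⊆ m ] ∑[ B ⊆ n ] (f A * g B)
∑⊆-product {n = n} f g =
  trans (*-distribʳ-∑⊆ (∑⊆ n g) f) (∑⊆-cong (λ A → *-distribˡ-∑⊆ (f A) g))

∑⊆-*-identityˡ : ∀ {n} (c f : Subset n → ℕ) → ∑[ T ⊆ n ] (c T * (1 * f T)) ≡ ∑[ T ⊆ n ] (c T * f T)
∑⊆-*-identityˡ c f = ∑⊆-cong (λ T → cong (c T *_) (*-identityˡ (f T)))

∑⊆-*-pull : ∀ {n} a (c f : Subset n → ℕ) → ∑[ T ⊆ n ] (c T * (a * f T)) ≡ a * ∑[ T ⊆ n ] (c T * f T)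
∑⊆-*-pull a c f = trans (∑⊆-cong (λ T → *-CS.x∙yz≈y∙xz (c T) a (f T))) (sym (*-distribˡ-∑⊆ a (λ T → c T * f T)))

∑⊆-*-zeroʳ : ∀ {n} (c : Subset n → ℕ) → ∑[ T ⊆ n ] (c T * 0) ≡ 0
∑⊆-*-zeroʳ {n} c = trans (∑⊆-cong (λ T → *-zeroʳ (c T))) (∑⊆-zero n)

∑⊆-insert : ∀ {n} (d : Fin n) (f : Subset n → ℕ) →
  ∑[ S ⊆ n ] (𝟙 (not (lookup S d)) * f (S [ d ]≔ true)) ≡ ∑[ S ⊆ n ] (𝟙 (lookup S d) * f S)
∑⊆-insert {suc n} zero    f = +-comm (∑[ S ⊆ n ] (1 * f (true ∷ S))) (∑[ S ⊆ n ] 0)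
∑⊆-insert {suc n} (suc d) f = cong₂ _+_ (∑⊆-insert d (f ∘ (false ∷_))) (∑⊆-insert d (f ∘ (true ∷_)))

∑⊆-remove : ∀ {n} (d : Fin n) (f : Subset n → ℕ) →
  ∑[ S ⊆ n ] (𝟙 (lookup S d) * f (S [ d ]≔ false)) ≡ ∑[ S ⊆ n ] (𝟙 (not (lookup S d)) * f S)
∑⊆-remove {suc n} zero    f = +-comm (∑[ S ⊆ n ] 0) (∑[ S ⊆ n ] (1 * f (false ∷ S)))
∑⊆-remove {suc n} (suc d) f = cong₂ _+_ (∑⊆-remove d (f ∘ (false ∷_))) (∑⊆-remove d (f ∘ (true ∷_)))

∑⊆-split : ∀ {n} (d : Fin n) (f : Subset n → ℕ) →
  ∑⊆ n f ≡ ∑[ S ⊆ n ] (𝟙 (not (lookup S d)) * f S) + ∑[ S ⊆ n ] (𝟙 (not (lookup S d)) * f (S [ d ]≔ true))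
∑⊆-split {n} d f = begin
  ∑⊆ n f
    ≡⟨ ∑⊆-cong split ⟩
  ∑[ S ⊆ n ] (𝟙 (not (lookup S d)) * f S + 𝟙 (lookup S d) * f S)
    ≡⟨ ∑⊆-distrib-+ (λ S → 𝟙 (not (lookup S d)) * f S) (λ S → 𝟙 (lookup S d) * f S) ⟩
  ∑[ S ⊆ n ] (𝟙 (not (lookup S d)) * f S) + ∑[ S ⊆ n ] (𝟙 (lookup S d) * f S)
    ≡⟨ cong (∑[ S ⊆ n ] (𝟙 (not (lookup S d)) * f S) +_) (∑⊆-insert d f) ⟨
  ∑[ S ⊆ n ] (𝟙 (not (lookup S d)) * f S) + ∑[ S ⊆ n ] (𝟙 (not (lookup S d)) * f (S [ d ]≔ true)) ∎
  where
  open ≡-Reasoning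
  split : ∀ S → f S ≡ 𝟙 (not (lookup S d)) * f S + 𝟙 (lookup S d) * f S
  split S = trans (sym (*-identityˡ (f S)))
                  (trans (cong (_* f S) (sym (𝟙-not (lookup S d)))) (*-distribʳ-+ (f S) (𝟙 (not (lookup S d))) (𝟙 (lookup S d))))

levelSum : ∀ n → ℕ → (Subset n → ℕ) → ℕ
levelSum n k f = ∑[ U ⊆ n ] (𝟙 (∣ U ∣ ≡ᵇ k) * f U)

levelSum-vanishes : ∀ {n} k (f : Subset n → ℕ) → n < k → levelSum n k f ≡ 0
levelSum-vanishes {n} k f n<k = trans (∑⊆-cong empty) (∑⊆-zero n)
  where
  empty : ∀ U → 𝟙 (∣ U ∣ ≡ᵇ k) * f U ≡ 0
  empty U with ∣ U ∣ ≡ᵇ k in eq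
  ... | true  = contradiction (≡ᵇ⇒≡ ∣ U ∣ k (subst T (sym eq) _)) (<⇒≢ (≤-<-trans (∣p∣≤n U) n<k))
  ... | false = refl

∑-mono-≤ : ∀ {m} {f g : Fin m → ℕ} → (∀ i → f i ≤ g i) → ∑[ i < m ] f i ≤ ∑[ i < m ] g i
∑-mono-≤ {zero}  f≤g = z≤n
∑-mono-≤ {suc m} f≤g = +-mono-≤ (f≤g zero) (∑-mono-≤ (f≤g ∘ suc))

∑-const : ∀ c x → ∑[ i < c ] x ≡ c * x
∑-const zero    x = refl
∑-const (suc c) x = cong (x +_) (∑-const c x)

∑-𝟙-≡ᵇ : ∀ {x k} → x ≤ k → ∑[ i < suc k ] 𝟙 (x ≡ᵇ toℕ i) ≡ 1
∑-𝟙-≡ᵇ {zero}  {k}     _         = cong suc (sum-replicate-zero k)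
∑-𝟙-≡ᵇ {suc x} {suc k} (s≤s x≤k) = ∑-𝟙-≡ᵇ x≤k

∣p∣≡∑𝟙 : ∀ {n} (U : Subset n) → ∣ U ∣ ≡ ∑[ d < n ] 𝟙 (lookup U d)
∣p∣≡∑𝟙 []          = refl
∣p∣≡∑𝟙 (true  ∷ U) = cong suc (∣p∣≡∑𝟙 U)
∣p∣≡∑𝟙 (false ∷ U) = ∣p∣≡∑𝟙 U

lookup-─ : ∀ {n} (A B : Subset n) d → lookup (A ─ B) d ≡ lookup A d ∧ not (lookup B d)
lookup-─ (a ∷ A) (true  ∷ B) zero    = sym (∧-zeroʳ a)
lookup-─ (a ∷ A) (false ∷ B) zero    = sym (∧-identityʳ a)
lookup-─ (a ∷ A) (true  ∷ B) (suc d) = lookup-─ A B d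
lookup-─ (a ∷ A) (false ∷ B) (suc d) = lookup-─ A B d

∣p∣≡∣p∩q∣+∣p─q∣ : ∀ {n} (A B : Subset n) → ∣ A ∣ ≡ ∣ A ∩ B ∣ + ∣ A ─ B ∣
∣p∣≡∣p∩q∣+∣p─q∣ []          []          = refl
∣p∣≡∣p∩q∣+∣p─q∣ (true  ∷ A) (true  ∷ B) = cong suc (∣p∣≡∣p∩q∣+∣p─q∣ A B)
∣p∣≡∣p∩q∣+∣p─q∣ (true  ∷ A) (false ∷ B) = trans (cong suc (∣p∣≡∣p∩q∣+∣p─q∣ A B)) (sym (+-suc _ _))
∣p∣≡∣p∩q∣+∣p─q∣ (false ∷ A) (true  ∷ B) = ∣p∣≡∣p∩q∣+∣p─q∣ A B
∣p∣≡∣p∩q∣+∣p─q∣ (false ∷ A) (false ∷ B) = ∣p∣≡∣p∩q∣+∣p─q∣ A B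

∣p[i]≔true∣≡1+∣p∣ : ∀ {n} (B : Subset n) d → lookup B d ≡ false → ∣ B [ d ]≔ true ∣ ≡ suc ∣ B ∣
∣p[i]≔true∣≡1+∣p∣ (false ∷ B) zero    _   = refl
∣p[i]≔true∣≡1+∣p∣ (false ∷ B) (suc d) d∉B = ∣p[i]≔true∣≡1+∣p∣ B d d∉B
∣p[i]≔true∣≡1+∣p∣ (true  ∷ B) (suc d) d∉B = cong suc (∣p[i]≔true∣≡1+∣p∣ B d d∉B)

∣p∣≡1+∣p[i]≔false∣ : ∀ {n} (A : Subset n) d → lookup A d ≡ true → ∣ A ∣ ≡ suc ∣ A [ d ]≔ false ∣
∣p∣≡1+∣p[i]≔false∣ (true  ∷ A) zero    _   = refl
∣p∣≡1+∣p[i]≔false∣ (false ∷ A) (suc d) d∈A = ∣p∣≡1+∣p[i]≔false∣ A d d∈A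
∣p∣≡1+∣p[i]≔false∣ (true  ∷ A) (suc d) d∈A = cong suc (∣p∣≡1+∣p[i]≔false∣ A d d∈A)

∣p∩q∣-move : ∀ {n} (A B : Subset n) d → lookup A d ≡ true → lookup B d ≡ false →
  ∣ (A [ d ]≔ false) ∩ (B [ d ]≔ true) ∣ ≡ ∣ A ∩ B ∣
∣p∩q∣-move (true ∷ A) (false ∷ B) zero    _   _   = refl
∣p∩q∣-move (a    ∷ A) (b     ∷ B) (suc d) d∈A d∉B with a ∧ b
... | true  = cong suc (∣p∩q∣-move A B d d∈A d∉B)
... | false = ∣p∩q∣-move A B d d∈A d∉B

[]≔-reinsert : ∀ {n} (A : Subset n) d → lookup A d ≡ true → (A [ d ]≔ false) [ d ]≔ true ≡ A
[]≔-reinsert A d d∈A = trans ([]≔-idempotent A d) (trans (cong (A [ d ]≔_) (sym d∈A)) ([]≔-lookup A d))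

∣p─q∣≡∣p∣∸∣p∩q∣ : ∀ {n} (A B : Subset n) → ∣ A ─ B ∣ ≡ ∣ A ∣ ∸ ∣ A ∩ B ∣
∣p─q∣≡∣p∣∸∣p∩q∣ A B = begin
  ∣ A ─ B ∣                         ≡⟨ m+n∸m≡n ∣ A ∩ B ∣ ∣ A ─ B ∣ ⟨
  ∣ A ∩ B ∣ + ∣ A ─ B ∣ ∸ ∣ A ∩ B ∣ ≡⟨ cong (_∸ ∣ A ∩ B ∣) (∣p∣≡∣p∩q∣+∣p─q∣ A B) ⟨
  ∣ A ∣ ∸ ∣ A ∩ B ∣                 ∎
  where open ≡-Reasoning

∑⊆-pull-𝟙 : ∀ {n} a (c : Subset n → Bool) (h : Subset n → ℕ) →
  ∑[ B ⊆ n ] (𝟙 (a ∧ c B) * h B) ≡ 𝟙 a * ∑[ B ⊆ n ] (𝟙 (c B) * h B)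
∑⊆-pull-𝟙 a c h =
  trans (∑⊆-cong (λ B → 𝟙-∧-* a (c B) (h B))) (sym (*-distribˡ-∑⊆ (𝟙 a) (λ B → 𝟙 (c B) * h B)))

∑⊆²-move : ∀ {n} (d : Fin n) (Ψ : Subset n → Subset n → ℕ) →
  ∑[ A ⊆ n ] ∑[ B ⊆ n ] (𝟙 (lookup A d ∧ not (lookup B d)) * Ψ (A [ d ]≔ false) (B [ d ]≔ true))
    ≡ ∑[ A ⊆ n ] ∑[ B ⊆ n ] (𝟙 (not (lookup A d) ∧ lookup B d) * Ψ A B)
∑⊆²-move {n} d Ψ = begin
  ∑[ A ⊆ n ] ∑[ B ⊆ n ] (𝟙 (lookup A d ∧ not (lookup B d)) * Ψ (A [ d ]≔ false) (B [ d ]≔ true))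
    ≡⟨ ∑⊆-cong (λ A → ∑⊆-pull-𝟙 (lookup A d) (λ B → not (lookup B d)) (Ψ (A [ d ]≔ false) ∘ (_[ d ]≔ true))) ⟩
  ∑[ A ⊆ n ] (𝟙 (lookup A d) * G (A [ d ]≔ false))
    ≡⟨ ∑⊆-remove d G ⟩
  ∑[ A ⊆ n ] (𝟙 (not (lookup A d)) * G A)
    ≡⟨ ∑⊆-cong (λ A → cong (𝟙 (not (lookup A d)) *_) (∑⊆-insert d (Ψ A))) ⟩
  ∑[ A ⊆ n ] (𝟙 (not (lookup A d)) * ∑[ B ⊆ n ] (𝟙 (lookup B d) * Ψ A B))
    ≡⟨ ∑⊆-cong (λ A → sym (∑⊆-pull-𝟙 (not (lookup A d)) (λ B → lookup B d) (Ψ A))) ⟩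
  ∑[ A ⊆ n ] ∑[ B ⊆ n ] (𝟙 (not (lookup A d) ∧ lookup B d) * Ψ A B) ∎
  where
  open ≡-Reasoning
  G : Subset n → ℕ
  G A = ∑[ B ⊆ n ] (𝟙 (not (lookup B d)) * Ψ A (B [ d ]≔ true))

levelSum-product : ∀ {n} x y (F H : Subset n → ℕ) →
  levelSum n x F * levelSum n y H ≡ ∑[ A ⊆ n ] ∑[ B ⊆ n ] (𝟙 ((∣ A ∣ ≡ᵇ x) ∧ (∣ B ∣ ≡ᵇ y)) * (F A * H B))
levelSum-product x y F H = trans (∑⊆-product (λ A → 𝟙 (∣ A ∣ ≡ᵇ x) * F A) (λ B → 𝟙 (∣ B ∣ ≡ᵇ y) * H B))
  (∑⊆-cong (λ A → ∑⊆-cong (λ B → trans (*-CS.interchange (𝟙 (∣ A ∣ ≡ᵇ x)) (F A) (𝟙 (∣ B ∣ ≡ᵇ y)) (H B))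
                                        (cong (_* (F A * H B)) (sym (𝟙-∧ (∣ A ∣ ≡ᵇ x) (∣ B ∣ ≡ᵇ y)))))))

-- Pairs (A, B) are grouped by |A ∩ B|. Moving some d ∈ A ∖ B from A to B maps the class of
-- sizes (k + 1, k) to the class of sizes (k, k + 1) with the same |A ∩ B| = i, and each pair of
-- either class arises from exactly k + 1 − i such moves.
module Exchange {n} (F H : Subset n → ℕ) (a b k : ℕ)
  (move : ∀ A B d → lookup A d ≡ true → lookup B d ≡ false →
          a * (F A * H B) ≤ b * (F (A [ d ]≔ false) * H (B [ d ]≔ true))) where

  inClass : ℕ → ℕ → ℕ → Subset n → Subset n → Bool
  inClass i x y A B = (∣ A ∩ B ∣ ≡ᵇ i) ∧ ((∣ A ∣ ≡ᵇ x) ∧ (∣ B ∣ ≡ᵇ y))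

  term : ℕ → ℕ → ℕ → Subset n → Subset n → ℕ
  term i x y A B = 𝟙 (inClass i x y A B) * (F A * H B)

  classSum : ℕ → ℕ → ℕ → ℕ
  classSum i x y = ∑[ A ⊆ n ] ∑[ B ⊆ n ] term i x y A B

  inClass-sizes : ∀ i x y A B → T (inClass i x y A B) → ∣ A ∩ B ∣ ≡ i × ∣ A ∣ ≡ x × ∣ B ∣ ≡ y
  inClass-sizes i x y A B t with Equivalence.to (T-∧ {∣ A ∩ B ∣ ≡ᵇ i}) t
  ... | tᵢ , tₓᵧ with Equivalence.to (T-∧ {∣ A ∣ ≡ᵇ x}) tₓᵧ
  ...   | tₓ , tᵧ = ≡ᵇ⇒≡ _ _ tᵢ , ≡ᵇ⇒≡ _ _ tₓ , ≡ᵇ⇒≡ _ _ tᵧ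

  inClass-move : ∀ i x y A B d → lookup A d ≡ true → lookup B d ≡ false →
    inClass i (suc x) y A B ≡ inClass i x (suc y) (A [ d ]≔ false) (B [ d ]≔ true)
  inClass-move i x y A B d d∈A d∉B
    rewrite ∣p∩q∣-move A B d d∈A d∉B | ∣p∣≡1+∣p[i]≔false∣ A d d∈A | ∣p[i]≔true∣≡1+∣p∣ B d d∉B = refl

  ∑³ : (Fin n → Subset n → Subset n → ℕ) → ℕ
  ∑³ g = ∑[ d < n ] ∑[ A ⊆ n ] ∑[ B ⊆ n ] g d A B

  ∑³-cong : ∀ {g h} → (∀ d A B → g d A B ≡ h d A B) → ∑³ g ≡ ∑³ h
  ∑³-cong g≗h = sum-cong-≗ (λ d → ∑⊆-cong (λ A → ∑⊆-cong (g≗h d A)))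

  ∑³-mono-≤ : ∀ {g h} → (∀ d A B → g d A B ≤ h d A B) → ∑³ g ≤ ∑³ h
  ∑³-mono-≤ g≤h = ∑-mono-≤ (λ d → ∑⊆-mono-≤ (λ A → ∑⊆-mono-≤ (g≤h d A)))

  *-distribˡ-∑³ : ∀ c g → c * ∑³ g ≡ ∑³ (λ d A B → c * g d A B)
  *-distribˡ-∑³ c g = trans (*-distribˡ-sum c (λ d → ∑[ A ⊆ n ] ∑[ B ⊆ n ] g d A B)) (sum-cong-≗ (λ d →
    trans (*-distribˡ-∑⊆ c (λ A → ∑⊆ n (g d A))) (∑⊆-cong (λ A → *-distribˡ-∑⊆ c (g d A)))))

  classSum-doubleCount : ∀ i x y c (δ : Subset n → Subset n → Subset n) →
    (∀ A B → T (inClass i x y A B) → ∣ δ A B ∣ ≡ c) →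
    c * classSum i x y ≡ ∑³ (λ d A B → 𝟙 (lookup (δ A B) d) * term i x y A B)
  classSum-doubleCount i x y c δ ∣δ∣≡c = begin
    c * classSum i x y
      ≡⟨ trans (*-distribˡ-∑⊆ c (λ A → ∑⊆ n (term i x y A))) (∑⊆-cong (λ A → *-distribˡ-∑⊆ c (term i x y A))) ⟩
    ∑[ A ⊆ n ] ∑[ B ⊆ n ] (c * term i x y A B)
      ≡⟨ ∑⊆-cong (λ A → ∑⊆-cong (λ B → sym (𝟙-*-cong _ (F A * H B) (∣δ∣≡c A B)))) ⟩
    ∑[ A ⊆ n ] ∑[ B ⊆ n ] (∣ δ A B ∣ * term i x y A B)
      ≡⟨ ∑⊆-cong (λ A → ∑⊆-cong (λ B →
           trans (cong (_* term i x y A B) (∣p∣≡∑𝟙 (δ A B))) (*-distribʳ-sum _ (λ d → 𝟙 (lookup (δ A B) d))))) ⟩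
    ∑[ A ⊆ n ] ∑[ B ⊆ n ] ∑[ d < n ] (𝟙 (lookup (δ A B) d) * term i x y A B)
      ≡⟨ ∑⊆-cong (λ A → ∑⊆-∑-comm (λ B d → 𝟙 (lookup (δ A B) d) * term i x y A B)) ⟩
    ∑[ A ⊆ n ] ∑[ d < n ] ∑[ B ⊆ n ] (𝟙 (lookup (δ A B) d) * term i x y A B)
      ≡⟨ ∑⊆-∑-comm (λ A d → ∑[ B ⊆ n ] (𝟙 (lookup (δ A B) d) * term i x y A B)) ⟩
    ∑³ (λ d A B → 𝟙 (lookup (δ A B) d) * term i x y A B) ∎
    where open ≡-Reasoning

  ∣p─q∣-inClass : ∀ i x y A B → T (inClass i x y A B) → ∣ A ─ B ∣ ≡ x ∸ i
  ∣p─q∣-inClass i x y A B t with inClass-sizes i x y A B t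
  ... | ∣A∩B∣≡i , ∣A∣≡x , _ = trans (∣p─q∣≡∣p∣∸∣p∩q∣ A B) (cong₂ _∸_ ∣A∣≡x ∣A∩B∣≡i)

  ∣q─p∣-inClass : ∀ i x y A B → T (inClass i x y A B) → ∣ B ─ A ∣ ≡ y ∸ i
  ∣q─p∣-inClass i x y A B t with inClass-sizes i x y A B t
  ... | ∣A∩B∣≡i , _ , ∣B∣≡y =
    trans (∣p─q∣≡∣p∣∸∣p∩q∣ B A) (cong₂ _∸_ ∣B∣≡y (trans (cong ∣_∣ (∩-comm B A)) ∣A∩B∣≡i))

  scale-𝟙 : ∀ c {X Y} → a * X ≤ b * Y → a * (𝟙 c * X) ≤ b * (𝟙 c * Y)
  scale-𝟙 true  {X} {Y} aX≤bY =
    subst₂ (λ u v → a * u ≤ b * v) (sym (*-identityˡ X)) (sym (*-identityˡ Y)) aX≤bY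
  scale-𝟙 false _ = subst₂ _≤_ (sym (*-zeroʳ a)) (sym (*-zeroʳ b)) z≤n

  term-move : ∀ i A B d →
    a * (𝟙 (lookup A d ∧ not (lookup B d)) * term i (suc k) k A B)
      ≤ 𝟙 (lookup A d ∧ not (lookup B d)) * (b * term i k (suc k) (A [ d ]≔ false) (B [ d ]≔ true))
  term-move i A B d with lookup A d in d∈A | lookup B d in d∉B
  ... | true  | true  = ≤-reflexive (*-zeroʳ a)
  ... | false | _     = ≤-reflexive (*-zeroʳ a)
  ... | true  | false = begin
    a * (1 * term i (suc k) k A B)
      ≡⟨ cong (a *_) (*-identityˡ _) ⟩
    a * (𝟙 (inClass i (suc k) k A B) * (F A * H B))
      ≡⟨ cong (λ c → a * (𝟙 c * (F A * H B))) (inClass-move i k k A B d d∈A d∉B) ⟩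
    a * (𝟙 (inClass i k (suc k) A′ B′) * (F A * H B))
      ≤⟨ scale-𝟙 (inClass i k (suc k) A′ B′) (move A B d d∈A d∉B) ⟩
    b * term i k (suc k) A′ B′
      ≡⟨ *-identityˡ _ ⟨
    1 * (b * term i k (suc k) A′ B′) ∎
    where
    open ≤-Reasoning
    A′ = A [ d ]≔ false
    B′ = B [ d ]≔ true

  classSum-exchange : ∀ i → i ≤ k → a * classSum i (suc k) k ≤ b * classSum i k (suc k)
  classSum-exchange i i≤k = *-cancelˡ-≤ (suc (k ∸ i)) (begin
    suc (k ∸ i) * (a * L)
      ≡⟨ cong (_* (a * L)) (+-∸-assoc 1 i≤k) ⟨
    (suc k ∸ i) * (a * L)
      ≡⟨ *-CS.x∙yz≈y∙xz (suc k ∸ i) a L ⟩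
    a * ((suc k ∸ i) * L)
      ≡⟨ cong (a *_) (classSum-doubleCount i (suc k) k (suc k ∸ i) _─_ (∣p─q∣-inClass i (suc k) k)) ⟩
    a * ∑³ (λ d A B → 𝟙 (lookup (A ─ B) d) * term i (suc k) k A B)
      ≡⟨ *-distribˡ-∑³ a _ ⟩
    ∑³ (λ d A B → a * (𝟙 (lookup (A ─ B) d) * term i (suc k) k A B))
      ≡⟨ ∑³-cong (λ d A B → cong (λ c → a * (𝟙 c * term i (suc k) k A B)) (lookup-─ A B d)) ⟩
    ∑³ (λ d A B → a * (𝟙 (lookup A d ∧ not (lookup B d)) * term i (suc k) k A B))
      ≤⟨ ∑³-mono-≤ (λ d A B → term-move i A B d) ⟩
    ∑³ (λ d A B → 𝟙 (lookup A d ∧ not (lookup B d))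
                    * (b * term i k (suc k) (A [ d ]≔ false) (B [ d ]≔ true)))
      ≡⟨ sum-cong-≗ (λ d → ∑⊆²-move d (λ A B → b * term i k (suc k) A B)) ⟩
    ∑³ (λ d A B → 𝟙 (not (lookup A d) ∧ lookup B d) * (b * term i k (suc k) A B))
      ≡⟨ ∑³-cong (λ d A B → back d A B) ⟩
    ∑³ (λ d A B → b * (𝟙 (lookup (B ─ A) d) * term i k (suc k) A B))
      ≡⟨ *-distribˡ-∑³ b _ ⟨
    b * ∑³ (λ d A B → 𝟙 (lookup (B ─ A) d) * term i k (suc k) A B)
      ≡⟨ cong (b *_) (classSum-doubleCount i k (suc k) (suc k ∸ i) (λ A B → B ─ A) (∣q─p∣-inClass i k (suc k))) ⟨
    b * ((suc k ∸ i) * R)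
      ≡⟨ *-CS.x∙yz≈y∙xz b (suc k ∸ i) R ⟩
    (suc k ∸ i) * (b * R)
      ≡⟨ cong (_* (b * R)) (+-∸-assoc 1 i≤k) ⟩
    suc (k ∸ i) * (b * R) ∎)
    where
    open ≤-Reasoning
    L = classSum i (suc k) k
    R = classSum i k (suc k)
    back : ∀ d A B → 𝟙 (not (lookup A d) ∧ lookup B d) * (b * term i k (suc k) A B)
                       ≡ b * (𝟙 (lookup (B ─ A) d) * term i k (suc k) A B)
    back d A B = trans (cong (λ c → 𝟙 c * _) (trans (∧-comm (not (lookup A d)) (lookup B d)) (sym (lookup-─ B A d))))
                       (*-CS.x∙yz≈y∙xz (𝟙 (lookup (B ─ A) d)) b (term i k (suc k) A B))

  classSum-partition : ∀ x y → (∀ A B → T ((∣ A ∣ ≡ᵇ x) ∧ (∣ B ∣ ≡ᵇ y)) → ∣ A ∩ B ∣ ≤ k) →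
    ∑[ i < suc k ] classSum (toℕ i) x y ≡ levelSum n x F * levelSum n y H
  classSum-partition x y bound = begin
    ∑[ i < suc k ] ∑[ A ⊆ n ] ∑[ B ⊆ n ] term (toℕ i) x y A B
      ≡⟨ ∑⊆-∑-comm {m = suc k} (λ A i → ∑[ B ⊆ n ] term (toℕ i) x y A B) ⟨
    ∑[ A ⊆ n ] ∑[ i < suc k ] ∑[ B ⊆ n ] term (toℕ i) x y A B
      ≡⟨ ∑⊆-cong (λ A → sym (∑⊆-∑-comm {m = suc k} (λ B i → term (toℕ i) x y A B))) ⟩
    ∑[ A ⊆ n ] ∑[ B ⊆ n ] ∑[ i < suc k ] term (toℕ i) x y A B
      ≡⟨ ∑⊆-cong (λ A → ∑⊆-cong (λ B → collapse A B)) ⟩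
    ∑[ A ⊆ n ] ∑[ B ⊆ n ] (𝟙 ((∣ A ∣ ≡ᵇ x) ∧ (∣ B ∣ ≡ᵇ y)) * (F A * H B))
      ≡⟨ levelSum-product x y F H ⟨
    levelSum n x F * levelSum n y H ∎
    where
    open ≡-Reasoning
    collapse : ∀ A B → ∑[ i < suc k ] term (toℕ i) x y A B ≡ 𝟙 ((∣ A ∣ ≡ᵇ x) ∧ (∣ B ∣ ≡ᵇ y)) * (F A * H B)
    collapse A B = begin
      ∑[ i < suc k ] term (toℕ i) x y A B
        ≡⟨ sum-cong-≗ {suc k} (λ i → 𝟙-∧-* (∣ A ∩ B ∣ ≡ᵇ toℕ i) e (F A * H B)) ⟩
      ∑[ i < suc k ] (𝟙 (∣ A ∩ B ∣ ≡ᵇ toℕ i) * (𝟙 e * (F A * H B)))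
        ≡⟨ *-distribʳ-sum {suc k} (𝟙 e * (F A * H B)) (λ i → 𝟙 (∣ A ∩ B ∣ ≡ᵇ toℕ i)) ⟨
      ∑[ i < suc k ] 𝟙 (∣ A ∩ B ∣ ≡ᵇ toℕ i) * (𝟙 e * (F A * H B))
        ≡⟨ 𝟙-*-cong e (F A * H B) (λ t → ∑-𝟙-≡ᵇ (bound A B t)) ⟩
      1 * (𝟙 e * (F A * H B))
        ≡⟨ *-identityˡ _ ⟩
      𝟙 e * (F A * H B) ∎
      where e = (∣ A ∣ ≡ᵇ x) ∧ (∣ B ∣ ≡ᵇ y)

  exchange : a * (levelSum n (suc k) F * levelSum n k H) ≤ b * (levelSum n k F * levelSum n (suc k) H)
  exchange = begin
    a * (levelSum n (suc k) F * levelSum n k H)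
      ≡⟨ cong (a *_) (classSum-partition (suc k) k boundˡ) ⟨
    a * ∑[ i < suc k ] classSum (toℕ i) (suc k) k
      ≡⟨ *-distribˡ-sum {suc k} a (λ i → classSum (toℕ i) (suc k) k) ⟩
    ∑[ i < suc k ] (a * classSum (toℕ i) (suc k) k)
      ≤⟨ ∑-mono-≤ {suc k} (λ i → classSum-exchange (toℕ i) (Finₚ.toℕ≤pred[n] i)) ⟩
    ∑[ i < suc k ] (b * classSum (toℕ i) k (suc k))
      ≡⟨ *-distribˡ-sum {suc k} b (λ i → classSum (toℕ i) k (suc k)) ⟨
    b * ∑[ i < suc k ] classSum (toℕ i) k (suc k)
      ≡⟨ cong (b *_) (classSum-partition k (suc k) boundʳ) ⟩
    b * (levelSum n k F * levelSum n (suc k) H) ∎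
    where
    open ≤-Reasoning
    boundˡ : ∀ A B → T ((∣ A ∣ ≡ᵇ suc k) ∧ (∣ B ∣ ≡ᵇ k)) → ∣ A ∩ B ∣ ≤ k
    boundˡ A B t = ≤-trans (∣p∩q∣≤∣q∣ A B) (≤-reflexive (≡ᵇ⇒≡ _ _ (proj₂ (Equivalence.to (T-∧ {∣ A ∣ ≡ᵇ suc k}) t))))
    boundʳ : ∀ A B → T ((∣ A ∣ ≡ᵇ k) ∧ (∣ B ∣ ≡ᵇ suc k)) → ∣ A ∩ B ∣ ≤ k
    boundʳ A B t = ≤-trans (∣p∩q∣≤∣p∣ A B) (≤-reflexive (≡ᵇ⇒≡ _ _ (proj₁ (Equivalence.to (T-∧ {∣ A ∣ ≡ᵇ k}) t))))

-- Newton's inequality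

amgm-≤ : ∀ {u v} → u ≤ v → 2 * (u * v) ≤ u * u + v * v
amgm-≤ {u} u≤v with m≤n⇒∃[o]m+o≡n u≤v
... | d , refl = ≤-trans (m≤m+n _ (d * d)) (≤-reflexive (square u d))
  where
  square : ∀ u d → 2 * (u * (u + d)) + d * d ≡ u * u + (u + d) * (u + d)
  square = solve-∀

amgm : ∀ u v → 2 * (u * v) ≤ u * u + v * v
amgm u v with ≤-total u v
... | inj₁ u≤v = amgm-≤ u≤v
... | inj₂ v≤u = subst₂ _≤_ (cong (2 *_) (*-comm v u)) (+-comm (v * v) (u * u)) (amgm-≤ v≤u)

-- Log-concavity of addVariable at K for n = 1 + K + A, with x₀ … x₃ = f (K − 1) … f (K + 2):
-- the hypotheses are log-concavity of f at K and K − 1 and logConcave-gap.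
linearFactor-inequality : ∀ A K t x₀ x₁ x₂ x₃ →
  x₁ * x₃ ≤ x₂ * x₂ → K * (x₀ * x₂) ≤ K * (x₁ * x₁) → K * (x₀ * x₃) ≤ K * (x₂ * x₁) →
  (suc (suc A) * x₁ + K * t * x₀) * (A * x₃ + suc (suc K) * t * x₂)
    ≤ (suc A * x₂ + suc K * t * x₁) * (suc A * x₂ + suc K * t * x₁)
linearFactor-inequality A K t x₀ x₁ x₂ x₃ lc₁ lc₀ gap = +-cancelʳ-≤ (2 * (x₂ * (t * x₁))) _ _ (begin
    (suc (suc A) * x₁ + K * t * x₀) * (A * x₃ + suc (suc K) * t * x₂) + 2 * (x₂ * (t * x₁))
  ≡⟨ cong (_+ 2 * (x₂ * (t * x₁))) (expand A K t x₀ x₁ x₂ x₃) ⟩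
    suc (suc A) * A * (x₁ * x₃) + suc (suc A) * suc (suc K) * t * (x₂ * x₁)
      + A * t * (K * (x₀ * x₃)) + suc (suc K) * t * t * (K * (x₀ * x₂)) + 2 * (x₂ * (t * x₁))
  ≤⟨ +-monoˡ-≤ _ (+-mono-≤ (+-mono-≤ (+-monoˡ-≤ _ (*-monoʳ-≤ (suc (suc A) * A) lc₁))
                                     (*-monoʳ-≤ (A * t) gap))
                           (*-monoʳ-≤ (suc (suc K) * t * t) lc₀)) ⟩
    suc (suc A) * A * (x₂ * x₂) + suc (suc A) * suc (suc K) * t * (x₂ * x₁)
      + A * t * (K * (x₂ * x₁)) + suc (suc K) * t * t * (K * (x₁ * x₁)) + 2 * (x₂ * (t * x₁))
  ≤⟨ +-monoʳ-≤ bound (amgm x₂ (t * x₁)) ⟩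
    suc (suc A) * A * (x₂ * x₂) + suc (suc A) * suc (suc K) * t * (x₂ * x₁)
      + A * t * (K * (x₂ * x₁)) + suc (suc K) * t * t * (K * (x₁ * x₁)) + (x₂ * x₂ + t * x₁ * (t * x₁))
  ≡⟨ collect A K t x₁ x₂ ⟩
    (suc A * x₂ + suc K * t * x₁) * (suc A * x₂ + suc K * t * x₁) + 2 * (x₂ * (t * x₁))
  ∎)
  where
  open ≤-Reasoning
  bound = suc (suc A) * A * (x₂ * x₂) + suc (suc A) * suc (suc K) * t * (x₂ * x₁)
            + A * t * (K * (x₂ * x₁)) + suc (suc K) * t * t * (K * (x₁ * x₁))
  expand : ∀ A K t x₀ x₁ x₂ x₃ →
    (suc (suc A) * x₁ + K * t * x₀) * (A * x₃ + suc (suc K) * t * x₂)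
      ≡ suc (suc A) * A * (x₁ * x₃) + suc (suc A) * suc (suc K) * t * (x₂ * x₁)
        + A * t * (K * (x₀ * x₃)) + suc (suc K) * t * t * (K * (x₀ * x₂))
  expand = solve-∀
  collect : ∀ A K t x₁ x₂ →
    suc (suc A) * A * (x₂ * x₂) + suc (suc A) * suc (suc K) * t * (x₂ * x₁)
      + A * t * (K * (x₂ * x₁)) + suc (suc K) * t * t * (K * (x₁ * x₁)) + (x₂ * x₂ + t * x₁ * (t * x₁))
      ≡ (suc A * x₂ + suc K * t * x₁) * (suc A * x₂ + suc K * t * x₁) + 2 * (x₂ * (t * x₁))
  collect = solve-∀

LogConcaveSequence : (ℕ → ℕ) → Set
LogConcaveSequence f = ∀ j → f j * f (2 + j) ≤ f (suc j) * f (suc j)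

record LogConcaveOn (n : ℕ) (f : ℕ → ℕ) : Set where
  field
    positive   : ∀ k → k ≤ n → 0 < f k
    vanishes   : ∀ k → n < k → f k ≡ 0
    logConcave : LogConcaveSequence f

logConcave-gap : ∀ {f} → LogConcaveSequence f → ∀ j → 0 < f (suc j) → 0 < f (2 + j) →
  f j * f (3 + j) ≤ f (2 + j) * f (suc j)
logConcave-gap {f} lc j f₁>0 f₂>0 =
  *-cancelʳ-≤ _ _ (f (2 + j) * f (suc j)) {{>-nonZero (*-mono-≤ f₂>0 f₁>0)}}
    (subst₂ _≤_ (shuffle (f j) (f (suc j)) (f (2 + j)) (f (3 + j))) (square (f (suc j)) (f (2 + j)))
                (*-mono-≤ (lc j) (lc (suc j))))
  where
  shuffle : ∀ x₀ x₁ x₂ x₃ → (x₀ * x₂) * (x₁ * x₃) ≡ (x₀ * x₃) * (x₂ * x₁)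
  shuffle = solve-∀
  square : ∀ x₁ x₂ → (x₁ * x₁) * (x₂ * x₂) ≡ (x₂ * x₁) * (x₂ * x₁)
  square = solve-∀

m+[n+o]∸n≡m+o : ∀ m n o → m + (n + o) ∸ n ≡ m + o
m+[n+o]∸n≡m+o m n o = trans (+-∸-assoc m (m≤m+n n o)) (cong (m +_) (m+n∸m≡n n o))

-- If f k = e_k k! (n − k)! for the elementary symmetric polynomials e_k of n weights, then
-- addVariable n t f k is the same quantity for the weights extended by t.
addVariable : ℕ → ℕ → (ℕ → ℕ) → ℕ → ℕ
addVariable n t f k = (suc n ∸ k) * f k + k * t * f (k ∸ 1)

module AddVariable {n t f} (t>0 : 0 < t) (lcf : LogConcaveOn n f) where
  open LogConcaveOn lcf

  g : ℕ → ℕ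
  g = addVariable n t f

  positive-g : ∀ k → k ≤ suc n → 0 < g k
  positive-g k k≤1+n with k ≤? n
  ... | yes k≤n = ≤-trans (*-mono-≤ (m<n⇒0<n∸m (s≤s k≤n)) (positive k k≤n)) (m≤m+n _ _)
  ... | no  k≰n rewrite ≤-antisym k≤1+n (≰⇒> k≰n) =
    ≤-trans (*-mono-≤ (*-mono-≤ {1} {suc n} (s≤s z≤n) t>0) (positive n ≤-refl)) (m≤n+m _ _)

  vanishes-g : ∀ k → suc n < k → g k ≡ 0
  vanishes-g (suc k) (s≤s n<k) =
    cong₂ _+_ (cong (_* f (suc k)) (m≤n⇒m∸n≡0 (<⇒≤ n<k))) (trans (cong (suc k * t *_) (vanishes k n<k)) (*-zeroʳ (suc k * t)))

  logConcave-g : LogConcaveSequence g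
  logConcave-g j with suc j ≤? n
  ... | no  j≮n = subst (_≤ g (suc j) * g (suc j))
                        (sym (trans (cong (g j *_) (vanishes-g (2 + j) (s≤s (≰⇒> j≮n)))) (*-zeroʳ (g j)))) z≤n
  ... | yes j<n with m≤n⇒∃[o]m+o≡n j<n
  ...   | A , refl = subst₂ _≤_
            (cong₂ _*_ (cong (λ c → c * f j + j * t * f (j ∸ 1)) (sym (m+[n+o]∸n≡m+o 2 j A)))
                       (cong (λ c → c * f (2 + j) + (2 + j) * t * f (suc j)) (sym (m+[n+o]∸n≡m+o 0 j A))))
            (cong₂ _*_ g₁≡ g₁≡)
            (linearFactor-inequality A j t (f (j ∸ 1)) (f j) (f (suc j)) (f (2 + j)) (logConcave j) (lc₀ j) (gap j (s≤s (m≤m+n j A))))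
    where
    g₁≡ : suc A * f (suc j) + suc j * t * f j ≡ g (suc j)
    g₁≡ = cong (λ c → c * f (suc j) + suc j * t * f j) (sym (m+[n+o]∸n≡m+o 1 j A))
    lc₀ : ∀ i → i * (f (i ∸ 1) * f (suc i)) ≤ i * (f i * f i)
    lc₀ zero    = z≤n
    lc₀ (suc i) = *-monoʳ-≤ (suc i) (logConcave i)
    gap : ∀ i → i < suc j + A → i * (f (i ∸ 1) * f (2 + i)) ≤ i * (f (suc i) * f i)
    gap zero    _   = z≤n
    gap (suc i) i<n = *-monoʳ-≤ (suc i) (logConcave-gap {f} logConcave i (positive (suc i) (<⇒≤ i<n)) (positive (2 + i) i<n))

LogConcaveOn-cong : ∀ {n f g} → (∀ k → f k ≡ g k) → LogConcaveOn n f → LogConcaveOn n g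
LogConcaveOn-cong f≗g lcf = record
  { positive   = λ k k≤n → subst (0 <_) (f≗g k) (positive k k≤n)
  ; vanishes   = λ k n<k → trans (sym (f≗g k)) (vanishes k n<k)
  ; logConcave = λ j → subst₂ _≤_ (cong₂ _*_ (f≗g j) (f≗g (2 + j))) (cong₂ _*_ (f≗g (suc j)) (f≗g (suc j)))
                                  (logConcave j)
  }
  where open LogConcaveOn lcf

addVariable-logConcaveOn : ∀ {n t f} → 0 < t → LogConcaveOn n f → LogConcaveOn (suc n) (addVariable n t f)
addVariable-logConcaveOn t>0 lcf = record
  { positive = positive-g ; vanishes = vanishes-g ; logConcave = logConcave-g }
  where open AddVariable t>0 lcf

monomial : ∀ {n} → (Fin n → ℕ) → Subset n → ℕ
monomial p []      = 1
monomial p (b ∷ U) = (if b then p zero else 1) * monomial (p ∘ suc) U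

esym : ∀ n → (Fin n → ℕ) → ℕ → ℕ
esym n p k = levelSum n k (monomial p)

esym-zero : ∀ n (p : Fin n → ℕ) → esym n p 0 ≡ 1
esym-zero zero    p = refl
esym-zero (suc n) p = begin
  ∑[ U ⊆ n ] (𝟙 (∣ U ∣ ≡ᵇ 0) * (1 * monomial (p ∘ suc) U)) + ∑[ U ⊆ n ] 0
    ≡⟨ cong₂ _+_ (∑⊆-cong (λ U → cong (𝟙 (∣ U ∣ ≡ᵇ 0) *_) (*-identityˡ (monomial (p ∘ suc) U)))) (∑⊆-zero n) ⟩
  esym n (p ∘ suc) 0 + 0
    ≡⟨ +-identityʳ _ ⟩
  esym n (p ∘ suc) 0
    ≡⟨ esym-zero n (p ∘ suc) ⟩
  1 ∎
  where open ≡-Reasoning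

esym-suc : ∀ n (p : Fin (suc n) → ℕ) k →
  esym (suc n) p (suc k) ≡ esym n (p ∘ suc) (suc k) + p zero * esym n (p ∘ suc) k
esym-suc n p k = cong₂ _+_
  (∑⊆-cong (λ U → cong (𝟙 (∣ U ∣ ≡ᵇ suc k) *_) (*-identityˡ (monomial (p ∘ suc) U))))
  (trans (∑⊆-cong (λ U → *-CS.x∙yz≈y∙xz (𝟙 (∣ U ∣ ≡ᵇ k)) (p zero) (monomial (p ∘ suc) U)))
         (sym (*-distribˡ-∑⊆ (p zero) (λ U → 𝟙 (∣ U ∣ ≡ᵇ k) * monomial (p ∘ suc) U))))

monomial-insert : ∀ {n} (p : Fin n → ℕ) B d → lookup B d ≡ false → monomial p (B [ d ]≔ true) ≡ p d * monomial p B
monomial-insert p (false ∷ B) zero    _   = cong (p zero *_) (sym (*-identityˡ _))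
monomial-insert p (b     ∷ B) (suc d) d∉B =
  trans (cong ((if b then p zero else 1) *_) (monomial-insert (p ∘ suc) B d d∉B))
        (*-CS.x∙yz≈y∙xz (if b then p zero else 1) (p (suc d)) _)

normalizedEsym : ∀ n → (Fin n → ℕ) → ℕ → ℕ
normalizedEsym n p k = esym n p k * k ! * (n ∸ k) !

normalizedEsym-suc : ∀ n (p : Fin (suc n) → ℕ) k →
  normalizedEsym (suc n) p k ≡ addVariable n (p zero) (normalizedEsym n (p ∘ suc)) k
normalizedEsym-suc n p zero = begin
  esym (suc n) p 0 * 1 * (suc n * n !)
    ≡⟨ cong (λ e → e * 1 * (suc n * n !)) (trans (esym-zero (suc n) p) (sym (esym-zero n (p ∘ suc)))) ⟩
  esym n (p ∘ suc) 0 * 1 * (suc n * n !)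
    ≡⟨ reassoc (esym n (p ∘ suc) 0) n (n !) ⟩
  suc n * (esym n (p ∘ suc) 0 * 1 * n !) + 0 ∎
  where
  open ≡-Reasoning
  reassoc : ∀ e n F → e * 1 * (suc n * F) ≡ suc n * (e * 1 * F) + 0
  reassoc = solve-∀
normalizedEsym-suc n p (suc k) = begin
  esym (suc n) p (suc k) * (suc k * k !) * (n ∸ k) !
    ≡⟨ cong (λ e → e * (suc k * k !) * (n ∸ k) !) (esym-suc n p k) ⟩
  (e₁ + t * e₀) * (suc k * k !) * (n ∸ k) !
    ≡⟨ distrib e₁ e₀ t k (k !) ((n ∸ k) !) ⟩
  suc k * k ! * (e₁ * (n ∸ k) !) + suc k * t * (e₀ * k ! * (n ∸ k) !)
    ≡⟨ cong (λ x → suc k * k ! * x + suc k * t * (e₀ * k ! * (n ∸ k) !)) e₁-factorial ⟩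
  suc k * k ! * ((n ∸ k) * (e₁ * (n ∸ suc k) !)) + suc k * t * (e₀ * k ! * (n ∸ k) !)
    ≡⟨ cong (_+ suc k * t * (e₀ * k ! * (n ∸ k) !)) (swap (suc k * k !) (n ∸ k) e₁ ((n ∸ suc k) !)) ⟩
  (n ∸ k) * (e₁ * (suc k * k !) * (n ∸ suc k) !) + suc k * t * (e₀ * k ! * (n ∸ k) !) ∎
  where
  open ≡-Reasoning
  t  = p zero
  e₁ = esym n (p ∘ suc) (suc k)
  e₀ = esym n (p ∘ suc) k
  distrib : ∀ e₁ e₀ t k F G → (e₁ + t * e₀) * (suc k * F) * G ≡ suc k * F * (e₁ * G) + suc k * t * (e₀ * F * G)
  distrib = solve-∀
  swap : ∀ a b e G → a * (b * (e * G)) ≡ b * (e * a * G)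
  swap = solve-∀
  e₁-factorial : e₁ * (n ∸ k) ! ≡ (n ∸ k) * (e₁ * (n ∸ suc k) !)
  e₁-factorial with k <? n
  ... | yes k<n rewrite +-∸-assoc 1 k<n = *-CS.x∙yz≈y∙xz e₁ (suc (n ∸ suc k)) ((n ∸ suc k) !)
  ... | no  k≮n rewrite levelSum-vanishes (suc k) (monomial (p ∘ suc)) (s≤s (≮⇒≥ k≮n)) = sym (*-zeroʳ (n ∸ k))

normalizedEsym-logConcaveOn : ∀ n (p : Fin n → ℕ) → (∀ i → 0 < p i) → LogConcaveOn n (normalizedEsym n p)
normalizedEsym-logConcaveOn zero p _ = record
  { positive   = λ { zero _ → s≤s z≤n }
  ; vanishes   = λ { (suc k) _ → refl }
  ; logConcave = λ j → ≤-trans (≤-reflexive (*-zeroʳ (normalizedEsym 0 p j))) z≤n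
  }
normalizedEsym-logConcaveOn (suc n) p p>0 =
  LogConcaveOn-cong (λ k → sym (normalizedEsym-suc n p k))
    (addVariable-logConcaveOn (p>0 zero) (normalizedEsym-logConcaveOn n (p ∘ suc) (p>0 ∘ suc)))

esym-positive : ∀ n (p : Fin n → ℕ) → (∀ i → 0 < p i) → ∀ k → k ≤ n → 0 < esym n p k
esym-positive n p p>0 k k≤n
  with esym n p k | LogConcaveOn.positive (normalizedEsym-logConcaveOn n p p>0) k k≤n
... | suc _ | _ = s≤s z≤n

newton-inequality : ∀ k m (p : Fin (2 + k + m) → ℕ) → (∀ i → 0 < p i) →
  (2 + k) * (2 + m) * (esym _ p k * esym _ p (2 + k)) ≤ (1 + k) * (1 + m) * (esym _ p (1 + k) * esym _ p (1 + k))
newton-inequality k m p p>0 = *-cancelˡ-≤ C {{>-nonZero C>0}}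
  (subst₂ _≤_ lhs rhs (LogConcaveOn.logConcave (normalizedEsym-logConcaveOn (2 + k + m) p p>0) k))
  where
  e₀ = esym _ p k
  e₁ = esym _ p (1 + k)
  e₂ = esym _ p (2 + k)
  C = (1 + k) * (1 + m) * (k ! * k !) * (m ! * m !)
  C>0 : 0 < C
  C>0 = *-mono-≤ (*-mono-≤ {1} {(1 + k) * (1 + m)} (s≤s z≤n) (*-mono-≤ (1≤n! k) (1≤n! k))) (*-mono-≤ (1≤n! m) (1≤n! m))
  lhs : normalizedEsym _ p k * normalizedEsym _ p (2 + k) ≡ C * ((2 + k) * (2 + m) * (e₀ * e₂))
  lhs = trans (cong₂ (λ a b → (e₀ * k ! * a !) * (e₂ * (2 + k) ! * b !)) (m+[n+o]∸n≡m+o 2 k m) (m+[n+o]∸n≡m+o 0 k m))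
              (expand e₀ e₂ k m (k !) (m !))
    where
    expand : ∀ e₀ e₂ k m F G → (e₀ * F * ((2 + m) * ((1 + m) * G))) * (e₂ * ((2 + k) * ((1 + k) * F)) * G)
                               ≡ (1 + k) * (1 + m) * (F * F) * (G * G) * ((2 + k) * (2 + m) * (e₀ * e₂))
    expand = solve-∀
  rhs : normalizedEsym _ p (1 + k) * normalizedEsym _ p (1 + k) ≡ C * ((1 + k) * (1 + m) * (e₁ * e₁))
  rhs = trans (cong (λ a → (e₁ * (1 + k) ! * a !) * (e₁ * (1 + k) ! * a !)) (m+[n+o]∸n≡m+o 1 k m))
              (expand e₁ k m (k !) (m !))
    where
    expand : ∀ e₁ k m F G → (e₁ * ((1 + k) * F) * ((1 + m) * G)) * (e₁ * ((1 + k) * F) * ((1 + m) * G))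
                            ≡ (1 + k) * (1 + m) * (F * F) * (G * G) * ((1 + k) * (1 + m) * (e₁ * e₁))
    expand = solve-∀

-- Independent sets of the corona, sorted by the blocks they meet

avoids : ∀ {m} → (Fin m → Bool) → Subset m → Bool
avoids f []      = true
avoids f (b ∷ U) = not (b ∧ f zero) ∧ avoids (f ∘ suc) U

independent : ∀ {m} → (Fin m → Fin m → Bool) → Subset m → Bool
independent E []          = true
independent E (false ∷ U) = independent (λ i j → E (suc i) (suc j)) U
independent E (true  ∷ U) = avoids (E zero ∘ suc) U ∧ independent (λ i j → E (suc i) (suc j)) U

avoids-insert : ∀ {m} (f : Fin m → Bool) S d → T (avoids f (S [ d ]≔ true)) → T (avoids f S)
avoids-insert f (false ∷ S) zero t with f zero
... | false = t
avoids-insert f (true  ∷ S) zero t = t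
avoids-insert f (s ∷ S) (suc d) t with not (s ∧ f zero)
... | true  = avoids-insert (f ∘ suc) S d t
... | false = t

independent-insert : ∀ {m} (E : Fin m → Fin m → Bool) S d → T (independent E (S [ d ]≔ true)) → T (independent E S)
independent-insert E (false ∷ S) zero t with avoids (E zero ∘ suc) S
... | true  = t
... | false = ⊥-elim t
independent-insert E (true  ∷ S) zero t = t
independent-insert E (false ∷ S) (suc d) t = independent-insert (λ i j → E (suc i) (suc j)) S d t
independent-insert E (true  ∷ S) (suc d) t
  with Equivalence.to (T-∧ {avoids (E zero ∘ suc) (S [ d ]≔ true)}) t
... | a , i = Equivalence.from T-∧ (avoids-insert (E zero ∘ suc) S d a , independent-insert (λ i j → E (suc i) (suc j)) S d i)

-- The number of ways an independent set can meet the block {v} ∪ K_c, given whether it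
-- contains v and whether it meets the block at all.
choices : ℕ → Bool → Bool → ℕ
choices c false false = 1
choices c false true  = c
choices c true  false = 0
choices c true  true  = 1

extensions : ∀ {n} → (Fin n → ℕ) → Subset n → Subset n → ℕ
extensions p []      []      = 1
extensions p (s ∷ S) (u ∷ U) = choices (p zero) s u * extensions (p ∘ suc) S U

touchCount : ∀ {n} → (Fin n → Fin n → Bool) → (Fin n → ℕ) → Subset n → ℕ
touchCount {n} E p U = ∑[ S ⊆ n ] (𝟙 (independent E S) * extensions p S U)

coronaCoeff : ∀ {n} → (Fin n → Fin n → Bool) → (Fin n → ℕ) → ℕ → ℕ
coronaCoeff {n} E p k = levelSum n k (touchCount E p)

extensions-touch : ∀ {n} (p : Fin n → ℕ) S U d → lookup S d ≡ false → lookup U d ≡ false →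
  extensions p S (U [ d ]≔ true) ≡ p d * extensions p S U
extensions-touch p (false ∷ S) (false ∷ U) zero _ _ = cong (p zero *_) (sym (*-identityˡ _))
extensions-touch p (s ∷ S) (u ∷ U) (suc d) d∉S d∉U =
  trans (cong (choices (p zero) s u *_) (extensions-touch (p ∘ suc) S U d d∉S d∉U))
        (*-CS.x∙yz≈y∙xz (choices (p zero) s u) (p (suc d)) _)

extensions-join : ∀ {n} (p : Fin n → ℕ) S U d → lookup S d ≡ false → lookup U d ≡ false →
  extensions p (S [ d ]≔ true) (U [ d ]≔ true) ≡ extensions p S U
extensions-join p (false ∷ S) (false ∷ U) zero    _   _   = refl
extensions-join p (s     ∷ S) (u     ∷ U) (suc d) d∉S d∉U =
  cong (choices (p zero) s u *_) (extensions-join (p ∘ suc) S U d d∉S d∉U)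

extensions-untouched : ∀ {n} (p : Fin n → ℕ) S U d → lookup U d ≡ false → extensions p (S [ d ]≔ true) U ≡ 0
extensions-untouched p (s ∷ S) (false ∷ U) zero    _   = refl
extensions-untouched p (s ∷ S) (u     ∷ U) (suc d) d∉U =
  trans (cong (choices (p zero) s u *_) (extensions-untouched (p ∘ suc) S U d d∉U)) (*-zeroʳ (choices (p zero) s u))

masked : ∀ {n} → (Fin n → ℕ) → Subset n → Fin n → ℕ
masked p S r = if not (lookup S r) then p r else 0

levelSum-extensions : ∀ {n} (p : Fin n → ℕ) (S : Subset n) s k →
  ∑[ T ⊆ n ] (𝟙 (s + ∣ S ∣ + ∣ T ∣ ≡ᵇ k) * monomial (masked p S) T)
    ≡ ∑[ W ⊆ n ] (𝟙 (s + ∣ W ∣ ≡ᵇ k) * extensions p S W)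
levelSum-extensions p [] s k = cong (λ x → 𝟙 (x ≡ᵇ k) * 1) (+-identityʳ (s + 0))
levelSum-extensions {suc n} p (false ∷ S) s k = cong₂ _+_
  (begin
    ∑[ T ⊆ n ] (𝟙 (s + ∣ S ∣ + ∣ T ∣ ≡ᵇ k) * (1 * M T))
      ≡⟨ ∑⊆-*-identityˡ (λ T → 𝟙 (s + ∣ S ∣ + ∣ T ∣ ≡ᵇ k)) M ⟩
    ∑[ T ⊆ n ] (𝟙 (s + ∣ S ∣ + ∣ T ∣ ≡ᵇ k) * M T)
      ≡⟨ levelSum-extensions (p ∘ suc) S s k ⟩
    ∑[ W ⊆ n ] (𝟙 (s + ∣ W ∣ ≡ᵇ k) * X W)
      ≡⟨ ∑⊆-*-identityˡ (λ W → 𝟙 (s + ∣ W ∣ ≡ᵇ k)) X ⟨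
    ∑[ W ⊆ n ] (𝟙 (s + ∣ W ∣ ≡ᵇ k) * (1 * X W)) ∎)
  (begin
    ∑[ T ⊆ n ] (𝟙 (s + ∣ S ∣ + suc ∣ T ∣ ≡ᵇ k) * (p zero * M T))
      ≡⟨ ∑⊆-*-pull (p zero) (λ T → 𝟙 (s + ∣ S ∣ + suc ∣ T ∣ ≡ᵇ k)) M ⟩
    p zero * ∑[ T ⊆ n ] (𝟙 (s + ∣ S ∣ + suc ∣ T ∣ ≡ᵇ k) * M T)
      ≡⟨ cong (p zero *_) (∑⊆-cong (λ T → cong (λ x → 𝟙 (x ≡ᵇ k) * M T) (+-suc (s + ∣ S ∣) ∣ T ∣))) ⟩
    p zero * ∑[ T ⊆ n ] (𝟙 (suc s + ∣ S ∣ + ∣ T ∣ ≡ᵇ k) * M T)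
      ≡⟨ cong (p zero *_) (levelSum-extensions (p ∘ suc) S (suc s) k) ⟩
    p zero * ∑[ W ⊆ n ] (𝟙 (suc s + ∣ W ∣ ≡ᵇ k) * X W)
      ≡⟨ cong (p zero *_) (∑⊆-cong (λ W → cong (λ x → 𝟙 (x ≡ᵇ k) * X W) (+-suc s ∣ W ∣))) ⟨
    p zero * ∑[ W ⊆ n ] (𝟙 (s + suc ∣ W ∣ ≡ᵇ k) * X W)
      ≡⟨ ∑⊆-*-pull (p zero) (λ W → 𝟙 (s + suc ∣ W ∣ ≡ᵇ k)) X ⟨
    ∑[ W ⊆ n ] (𝟙 (s + suc ∣ W ∣ ≡ᵇ k) * (p zero * X W)) ∎)
  where
  open ≡-Reasoning
  M X : Subset n → ℕ
  M = monomial (masked (p ∘ suc) S)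
  X = extensions (p ∘ suc) S
levelSum-extensions {suc n} p (true ∷ S) s k = begin
  ∑[ T ⊆ n ] (𝟙 (s + suc ∣ S ∣ + ∣ T ∣ ≡ᵇ k) * (1 * M T)) + ∑[ T ⊆ n ] (𝟙 (s + suc ∣ S ∣ + suc ∣ T ∣ ≡ᵇ k) * 0)
    ≡⟨ cong₂ _+_ (∑⊆-*-identityˡ (λ T → 𝟙 (s + suc ∣ S ∣ + ∣ T ∣ ≡ᵇ k)) M)
                 (∑⊆-*-zeroʳ {n} (λ T → 𝟙 (s + suc ∣ S ∣ + suc ∣ T ∣ ≡ᵇ k))) ⟩
  ∑[ T ⊆ n ] (𝟙 (s + suc ∣ S ∣ + ∣ T ∣ ≡ᵇ k) * M T) + 0
    ≡⟨ +-identityʳ _ ⟩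
  ∑[ T ⊆ n ] (𝟙 (s + suc ∣ S ∣ + ∣ T ∣ ≡ᵇ k) * M T)
    ≡⟨ ∑⊆-cong (λ T → cong (λ x → 𝟙 (x + ∣ T ∣ ≡ᵇ k) * M T) (+-suc s ∣ S ∣)) ⟩
  ∑[ T ⊆ n ] (𝟙 (suc s + ∣ S ∣ + ∣ T ∣ ≡ᵇ k) * M T)
    ≡⟨ levelSum-extensions (p ∘ suc) S (suc s) k ⟩
  ∑[ W ⊆ n ] (𝟙 (suc s + ∣ W ∣ ≡ᵇ k) * X W)
    ≡⟨ ∑⊆-cong (λ W → cong (λ x → 𝟙 (x ≡ᵇ k) * X W) (+-suc s ∣ W ∣)) ⟨
  ∑[ W ⊆ n ] (𝟙 (s + suc ∣ W ∣ ≡ᵇ k) * X W)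
    ≡⟨ ∑⊆-*-identityˡ (λ W → 𝟙 (s + suc ∣ W ∣ ≡ᵇ k)) X ⟨
  ∑[ W ⊆ n ] (𝟙 (s + suc ∣ W ∣ ≡ᵇ k) * (1 * X W))
    ≡⟨ cong (_+ ∑[ W ⊆ n ] (𝟙 (s + suc ∣ W ∣ ≡ᵇ k) * (1 * X W))) (∑⊆-*-zeroʳ {n} (λ W → 𝟙 (s + ∣ W ∣ ≡ᵇ k))) ⟨
  ∑[ W ⊆ n ] (𝟙 (s + ∣ W ∣ ≡ᵇ k) * 0) + ∑[ W ⊆ n ] (𝟙 (s + suc ∣ W ∣ ≡ᵇ k) * (1 * X W)) ∎
  where
  open ≡-Reasoning
  M X : Subset n → ℕ
  M = monomial (masked (p ∘ suc) S)
  X = extensions (p ∘ suc) S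

module TouchCount {n} (E : Fin n → Fin n → Bool) (p : Fin n → ℕ) where

  avoiding extendable : Subset n → Fin n → ℕ
  avoiding   U d = ∑[ S ⊆ n ] (𝟙 (not (lookup S d)) * (𝟙 (independent E S) * extensions p S U))
  extendable U d = ∑[ S ⊆ n ] (𝟙 (not (lookup S d)) * (𝟙 (independent E (S [ d ]≔ true)) * extensions p S U))

  touchCount-untouched : ∀ U d → lookup U d ≡ false → touchCount E p U ≡ avoiding U d
  touchCount-untouched U d d∉U = begin
    touchCount E p U
      ≡⟨ ∑⊆-split d (λ S → 𝟙 (independent E S) * extensions p S U) ⟩
    avoiding U d + ∑[ S ⊆ n ] (𝟙 (not (lookup S d)) * (𝟙 (independent E (S [ d ]≔ true)) * extensions p (S [ d ]≔ true) U))
      ≡⟨ cong (avoiding U d +_) (trans (∑⊆-cong vanish) (∑⊆-zero n)) ⟩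
    avoiding U d + 0
      ≡⟨ +-identityʳ _ ⟩
    avoiding U d ∎
    where
    open ≡-Reasoning
    vanish : ∀ S → 𝟙 (not (lookup S d)) * (𝟙 (independent E (S [ d ]≔ true)) * extensions p (S [ d ]≔ true) U) ≡ 0
    vanish S rewrite extensions-untouched p S U d d∉U | *-zeroʳ (𝟙 (independent E (S [ d ]≔ true))) = *-zeroʳ (𝟙 (not (lookup S d)))

  touchCount-touched : ∀ U d → lookup U d ≡ false → touchCount E p (U [ d ]≔ true) ≡ p d * avoiding U d + extendable U d
  touchCount-touched U d d∉U =
    trans (∑⊆-split d (λ S → 𝟙 (independent E S) * extensions p S (U [ d ]≔ true)))
          (cong₂ _+_ (trans (∑⊆-cong touch) (sym (*-distribˡ-∑⊆ (p d) (λ S → 𝟙 (not (lookup S d)) * (𝟙 (independent E S) * extensions p S U))))) (∑⊆-cong join))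
    where
    touch : ∀ S → 𝟙 (not (lookup S d)) * (𝟙 (independent E S) * extensions p S (U [ d ]≔ true))
                    ≡ p d * (𝟙 (not (lookup S d)) * (𝟙 (independent E S) * extensions p S U))
    touch S with lookup S d in d∉S
    ... | true  = sym (*-zeroʳ (p d))
    ... | false = trans (cong (λ x → 1 * (𝟙 (independent E S) * x)) (extensions-touch p S U d d∉S d∉U))
                        (swap (𝟙 (independent E S)) (p d) (extensions p S U))
      where
      swap : ∀ a b c → 1 * (a * (b * c)) ≡ b * (1 * (a * c))
      swap = solve-∀
    join : ∀ S → 𝟙 (not (lookup S d)) * (𝟙 (independent E (S [ d ]≔ true)) * extensions p (S [ d ]≔ true) (U [ d ]≔ true))
                   ≡ 𝟙 (not (lookup S d)) * (𝟙 (independent E (S [ d ]≔ true)) * extensions p S U)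
    join S with lookup S d in d∉S
    ... | true  = refl
    ... | false = cong (λ x → 1 * (𝟙 (independent E (S [ d ]≔ true)) * x)) (extensions-join p S U d d∉S d∉U)

  extendable≤avoiding : ∀ U d → extendable U d ≤ avoiding U d
  extendable≤avoiding U d = ∑⊆-mono-≤ (λ S →
    *-monoʳ-≤ (𝟙 (not (lookup S d))) (*-monoˡ-≤ (extensions p S U) (𝟙-mono-≤ (independent-insert E S d))))

  touchCount-lower : ∀ U d → lookup U d ≡ false → p d * touchCount E p U ≤ touchCount E p (U [ d ]≔ true)
  touchCount-lower U d d∉U =
    subst₂ _≤_ (cong (p d *_) (sym (touchCount-untouched U d d∉U))) (sym (touchCount-touched U d d∉U))
      (m≤m+n (p d * avoiding U d) (extendable U d))

  touchCount-upper : ∀ U d → lookup U d ≡ false → touchCount E p (U [ d ]≔ true) ≤ suc (p d) * touchCount E p U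
  touchCount-upper U d d∉U =
    subst₂ _≤_ (sym (touchCount-touched U d d∉U))
               (trans (+-comm (p d * avoiding U d) (avoiding U d)) (cong (suc (p d) *_) (sym (touchCount-untouched U d d∉U))))
      (+-monoʳ-≤ (p d * avoiding U d) (extendable≤avoiding U d))

module _ {n} (E : Fin n → Fin n → Bool) (p : Fin n → ℕ) where
  open TouchCount E p using (touchCount-lower; touchCount-upper)

  esym-coronaCoeff-exchange : ∀ k → esym n p (suc k) * coronaCoeff E p k ≤ esym n p k * coronaCoeff E p (suc k)
  esym-coronaCoeff-exchange k =
    subst₂ _≤_ (+-identityʳ _) (+-identityʳ _) (Exchange.exchange (monomial p) (touchCount E p) 1 1 k move)
    where
    move : ∀ A B d → lookup A d ≡ true → lookup B d ≡ false →
      1 * (monomial p A * touchCount E p B) ≤ 1 * (monomial p (A [ d ]≔ false) * touchCount E p (B [ d ]≔ true))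
    move A B d d∈A d∉B = *-monoʳ-≤ 1 (begin
      monomial p A * touchCount E p B
        ≡⟨ cong (λ A → monomial p A * touchCount E p B) ([]≔-reinsert A d d∈A) ⟨
      monomial p (U [ d ]≔ true) * touchCount E p B
        ≡⟨ cong (_* touchCount E p B) (monomial-insert p U d (lookup∘update d A false)) ⟩
      p d * monomial p U * touchCount E p B
        ≡⟨ *-CS.xy∙z≈y∙xz (p d) (monomial p U) (touchCount E p B) ⟩
      monomial p U * (p d * touchCount E p B)
        ≤⟨ *-monoʳ-≤ (monomial p U) (touchCount-lower B d d∉B) ⟩
      monomial p U * touchCount E p (B [ d ]≔ true) ∎)
      where
      open ≤-Reasoning
      U = A [ d ]≔ false

  coronaCoeff-esym-exchange : ∀ q k → (∀ v → q ≤ p v) →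
    q * (coronaCoeff E p (suc k) * esym n p k) ≤ suc q * (coronaCoeff E p k * esym n p (suc k))
  coronaCoeff-esym-exchange q k q≤p = Exchange.exchange (touchCount E p) (monomial p) q (suc q) k move
    where
    move : ∀ A B d → lookup A d ≡ true → lookup B d ≡ false →
      q * (touchCount E p A * monomial p B) ≤ suc q * (touchCount E p (A [ d ]≔ false) * monomial p (B [ d ]≔ true))
    move A B d d∈A d∉B = begin
      q * (touchCount E p A * monomial p B)
        ≡⟨ cong (λ A → q * (touchCount E p A * monomial p B)) ([]≔-reinsert A d d∈A) ⟨
      q * (touchCount E p (U [ d ]≔ true) * monomial p B)
        ≤⟨ *-monoʳ-≤ q (*-monoˡ-≤ (monomial p B) (touchCount-upper U d (lookup∘update d A false))) ⟩
      q * (suc (p d) * touchCount E p U * monomial p B)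
        ≡⟨ regroup q (p d) (touchCount E p U) (monomial p B) ⟩
      (q + q * p d) * (touchCount E p U * monomial p B)
        ≤⟨ *-monoˡ-≤ (touchCount E p U * monomial p B) (+-monoˡ-≤ (q * p d) (q≤p d)) ⟩
      (p d + q * p d) * (touchCount E p U * monomial p B)
        ≡⟨ factor q (p d) (touchCount E p U) (monomial p B) ⟩
      suc q * (touchCount E p U * (p d * monomial p B))
        ≡⟨ cong (λ x → suc q * (touchCount E p U * x)) (monomial-insert p B d d∉B) ⟨
      suc q * (touchCount E p U * monomial p (B [ d ]≔ true)) ∎
      where
      open ≤-Reasoning
      U = A [ d ]≔ false
      regroup : ∀ q x s w → q * (suc x * s * w) ≡ (q + q * x) * (s * w)
      regroup = solve-∀
      factor : ∀ q x s w → (x + q * x) * (s * w) ≡ suc q * (s * (x * w))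
      factor = solve-∀

-- Counting the independent sets of the corona

module _ {X : Set} where

  countSublists : (List X → Bool) → List X → ℕ
  countSublists R []      = 𝟙 (R [])
  countSublists R (x ∷ L) = countSublists R L + countSublists (R ∘ (x ∷_)) L

  countSublists-cong : ∀ L {R R′ : List X → Bool} → (∀ S → R S ≡ R′ S) → countSublists R L ≡ countSublists R′ L
  countSublists-cong []      R≗R′ = cong 𝟙 (R≗R′ [])
  countSublists-cong (x ∷ L) R≗R′ = cong₂ _+_ (countSublists-cong L R≗R′) (countSublists-cong L (R≗R′ ∘ (x ∷_)))

  countSublists-false : ∀ L {R : List X → Bool} → (∀ S → R S ≡ false) → countSublists R L ≡ 0
  countSublists-false []      R≗false = cong 𝟙 (R≗false [])
  countSublists-false (x ∷ L) R≗false = cong₂ _+_ (countSublists-false L R≗false) (countSublists-false L (R≗false ∘ (x ∷_)))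

  length-filterᵇ-++ : ∀ (R : List X → Bool) ys zs →
    length (filterᵇ R (ys ++ zs)) ≡ length (filterᵇ R ys) + length (filterᵇ R zs)
  length-filterᵇ-++ R []       zs = refl
  length-filterᵇ-++ R (y ∷ ys) zs with R y
  ... | true  = cong suc (length-filterᵇ-++ R ys zs)
  ... | false = length-filterᵇ-++ R ys zs

  length-filterᵇ-map-∷ : ∀ (R : List X → Bool) x ys →
    length (filterᵇ R (map (x ∷_) ys)) ≡ length (filterᵇ (R ∘ (x ∷_)) ys)
  length-filterᵇ-map-∷ R x []       = refl
  length-filterᵇ-map-∷ R x (y ∷ ys) with R (x ∷ y)
  ... | true  = cong suc (length-filterᵇ-map-∷ R x ys)
  ... | false = length-filterᵇ-map-∷ R x ys

  length-filterᵇ-sublists : ∀ (R : List X → Bool) L → length (filterᵇ R (sublists L)) ≡ countSublists R L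
  length-filterᵇ-sublists R [] with R []
  ... | true  = refl
  ... | false = refl
  length-filterᵇ-sublists R (x ∷ L) = trans (length-filterᵇ-++ R (sublists L) (map (x ∷_) (sublists L)))
    (cong₂ _+_ (length-filterᵇ-sublists R L)
               (trans (length-filterᵇ-map-∷ R x (sublists L)) (length-filterᵇ-sublists (R ∘ (x ∷_)) L)))

  filterᵇ-filterᵇ : ∀ (P Q : List X → Bool) ys → filterᵇ Q (filterᵇ P ys) ≡ filterᵇ (λ S → P S ∧ Q S) ys
  filterᵇ-filterᵇ P Q []       = refl
  filterᵇ-filterᵇ P Q (y ∷ ys) with P y
  ... | false = filterᵇ-filterᵇ P Q ys
  ... | true with Q y
  ...   | true  = cong (y ∷_) (filterᵇ-filterᵇ P Q ys)
  ...   | false = filterᵇ-filterᵇ P Q ys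

  allᵇ-∧ : ∀ (P Q : X → Bool) S → allᵇ (λ y → P y ∧ Q y) S ≡ (allᵇ P S ∧ allᵇ Q S)
  allᵇ-∧ P Q []      = refl
  allᵇ-∧ P Q (y ∷ S) rewrite allᵇ-∧ P Q S = ∧-CS.interchange (P y) (Q y) (allᵇ P S) (allᵇ Q S)

  allᵇ-true : ∀ S → allᵇ (λ (_ : X) → true) S ≡ true
  allᵇ-true []      = refl
  allᵇ-true (y ∷ S) = allᵇ-true S

  module _ (A : X → X → Bool) where

    countIndep : (X → Bool) → List X → ℕ → ℕ
    countIndep allowed []      zero    = 1
    countIndep allowed []      (suc k) = 0
    countIndep allowed (x ∷ L) zero    = countIndep allowed L zero
    countIndep allowed (x ∷ L) (suc k) =
      countIndep allowed L (suc k) + (if allowed x then countIndep (λ y → allowed y ∧ not (A x y)) L k else 0)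

    isIndepSublist : (X → Bool) → ℕ → List X → Bool
    isIndepSublist allowed k S = (independentᵇ A S ∧ allᵇ allowed S) ∧ (length S ≡ᵇ k)

    isIndepSublist-∷ : ∀ allowed k x S →
      isIndepSublist allowed (suc k) (x ∷ S) ≡ allowed x ∧ isIndepSublist (λ y → allowed y ∧ not (A x y)) k S
    isIndepSublist-∷ allowed k x S =
      trans (rearrange (allᵇ (not ∘ A x) S) (independentᵇ A S) (allowed x) (allᵇ allowed S) (length S ≡ᵇ k))
            (cong (λ z → allowed x ∧ ((independentᵇ A S ∧ z) ∧ (length S ≡ᵇ k))) (sym (allᵇ-∧ allowed (not ∘ A x) S)))
      where
      rearrange : ∀ N I a Al E → (((N ∧ I) ∧ (a ∧ Al)) ∧ E) ≡ (a ∧ ((I ∧ (Al ∧ N)) ∧ E))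
      rearrange N I true  Al E = cong (_∧ E) (∧-CS.xy∙z≈y∙zx N I Al)
      rearrange N I false Al E = cong (_∧ E) (∧-zeroʳ (N ∧ I))

    countSublists-isIndepSublist : ∀ L allowed k → countSublists (isIndepSublist allowed k) L ≡ countIndep allowed L k
    countSublists-isIndepSublist []      allowed zero    = refl
    countSublists-isIndepSublist []      allowed (suc k) = refl
    countSublists-isIndepSublist (x ∷ L) allowed zero    =
      trans (cong₂ _+_ (countSublists-isIndepSublist L allowed zero)
                       (countSublists-false L (λ S → ∧-zeroʳ (independentᵇ A (x ∷ S) ∧ allᵇ allowed (x ∷ S)))))
            (+-identityʳ _)
    countSublists-isIndepSublist (x ∷ L) allowed (suc k) =
      cong₂ _+_ (countSublists-isIndepSublist L allowed (suc k))
                (trans (countSublists-cong L (isIndepSublist-∷ allowed k x)) (headChosen (allowed x)))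
      where
      allowed′ : X → Bool
      allowed′ y = allowed y ∧ not (A x y)
      headChosen : ∀ b → countSublists (λ S → b ∧ isIndepSublist allowed′ k S) L ≡ (if b then countIndep allowed′ L k else 0)
      headChosen true  = countSublists-isIndepSublist L allowed′ k
      headChosen false = countSublists-false L (λ _ → refl)

    countIndep-zero : ∀ L allowed → countIndep allowed L 0 ≡ 1
    countIndep-zero []      allowed = refl
    countIndep-zero (x ∷ L) allowed = countIndep-zero L allowed

    countIndep-forbidden : ∀ {c} (x : Fin c → X) R allowed k → (∀ i → allowed (x i) ≡ false) →
      countIndep allowed (tabulate x ++ R) k ≡ countIndep allowed R k
    countIndep-forbidden {zero}  x R allowed k       _        = refl
    countIndep-forbidden {suc c} x R allowed zero    x∉allowed     = countIndep-forbidden (x ∘ suc) R allowed zero (x∉allowed ∘ suc)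
    countIndep-forbidden {suc c} x R allowed (suc k) x∉allowed rewrite x∉allowed zero =
      trans (+-identityʳ _) (countIndep-forbidden (x ∘ suc) R allowed (suc k) (x∉allowed ∘ suc))

    countIndep-clique : ∀ {c} (x : Fin c → X) R allowed k → (∀ i j → i ≢ j → A (x i) (x j) ≡ true) →
      countIndep allowed (tabulate x ++ R) (suc k)
        ≡ countIndep allowed R (suc k) + ∑[ i < c ] (if allowed (x i) then countIndep (λ y → allowed y ∧ not (A (x i) y)) R k else 0)
    countIndep-clique {zero}  x R allowed k _      = sym (+-identityʳ _)
    countIndep-clique {suc c} x R allowed k clique =
      trans (cong₂ _+_ (countIndep-clique (x ∘ suc) R allowed k (λ i j i≢j → clique (suc i) (suc j) (i≢j ∘ Finₚ.suc-injective)))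
                       first)
            (+-CS.xy∙z≈x∙zy (countIndep allowed R (suc k)) _ _)
      where
      allowed′ : X → Bool
      allowed′ y = allowed y ∧ not (A (x zero) y)
      first : (if allowed (x zero) then countIndep allowed′ (tabulate (x ∘ suc) ++ R) k else 0)
                ≡ (if allowed (x zero) then countIndep allowed′ R k else 0)
      first with allowed (x zero)
      ... | false = refl
      ... | true  = countIndep-forbidden (x ∘ suc) R allowed′ k
                      (λ i → trans (cong (λ b → allowed (x (suc i)) ∧ not b) (clique zero (suc i) (λ ()))) (∧-zeroʳ _))

shiftBy : ℕ → (ℕ → ℕ) → ℕ → ℕ
shiftBy zero    f k       = f k
shiftBy (suc s) f zero    = 0
shiftBy (suc s) f (suc k) = shiftBy s f k

shiftBy-levelSum : ∀ {n} s (f : Subset n → ℕ) k →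
  shiftBy s (λ k → levelSum n k f) k ≡ ∑[ T ⊆ n ] (𝟙 (s + ∣ T ∣ ≡ᵇ k) * f T)
shiftBy-levelSum     zero    f k       = refl
shiftBy-levelSum {n} (suc s) f zero    = sym (∑⊆-zero n)
shiftBy-levelSum     (suc s) f (suc k) = shiftBy-levelSum s f k

shiftBy-cong : ∀ s {f g : ℕ → ℕ} → (∀ k → f k ≡ g k) → ∀ k → shiftBy s f k ≡ shiftBy s g k
shiftBy-cong zero    f≗g k       = f≗g k
shiftBy-cong (suc s) f≗g zero    = refl
shiftBy-cong (suc s) f≗g (suc k) = shiftBy-cong s f≗g k

==ᶠ-refl : ∀ {k} (v : Fin k) → (v ==ᶠ v) ≡ true
==ᶠ-refl v with v Finₚ.≟ v
... | yes _   = refl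
... | no  v≢v = contradiction refl v≢v

==ᶠ-≢ : ∀ {k} {u v : Fin k} → u ≢ v → (u ==ᶠ v) ≡ false
==ᶠ-≢ {u = u} {v} u≢v with u Finₚ.≟ v
... | yes u≡v = contradiction u≡v u≢v
... | no  _   = refl

==ᶠ-suc : ∀ {k} (u v : Fin k) → (suc u ==ᶠ suc v) ≡ (u ==ᶠ v)
==ᶠ-suc u v with u Finₚ.≟ v
... | yes _ = refl
... | no  _ = refl

hits : ∀ {m k} → (Fin m → Fin k) → Subset m → Fin k → Bool
hits g []      v = false
hits g (b ∷ U) v = (b ∧ (g zero ==ᶠ v)) ∨ hits (g ∘ suc) U v

hits-suc-zero : ∀ {m k} (g : Fin m → Fin k) U → hits (λ i → suc (g i)) U zero ≡ false
hits-suc-zero g []          = refl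
hits-suc-zero g (false ∷ U) = hits-suc-zero (g ∘ suc) U
hits-suc-zero g (true  ∷ U) = hits-suc-zero (g ∘ suc) U

hits-suc-suc : ∀ {m k} (g : Fin m → Fin k) U v → hits (λ i → suc (g i)) U (suc v) ≡ hits g U v
hits-suc-suc g []      v = refl
hits-suc-suc g (b ∷ U) v = cong₂ (λ x y → (b ∧ x) ∨ y) (==ᶠ-suc (g zero) v) (hits-suc-suc (g ∘ suc) U v)

hits-id : ∀ {m} (U : Subset m) v → hits (λ i → i) U v ≡ lookup U v
hits-id (b ∷ U) zero    =
  trans (cong ((b ∧ true) ∨_) (hits-suc-zero (λ i → i) U)) (trans (∨-identityʳ (b ∧ true)) (∧-identityʳ b))
hits-id (b ∷ U) (suc v) =
  trans (cong₂ _∨_ (∧-zeroʳ b) (hits-suc-suc (λ i → i) U v)) (hits-id U v)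

module CoronaCount {n} (G : Graph n) (p : Fin n → ℕ) where

  Vertex : Set
  Vertex = Fin n ⊎ Σ (Fin n) (λ v → Fin (p v))

  Adj : Vertex → Vertex → Bool
  Adj = adjF (coronaK G p)

  clique : Fin n → List Vertex
  clique v = tabulate (λ i → inj₂ (v , i))

  cliques : List Vertex
  cliques = concat (tabulate clique)

  verts-coronaK : verts (coronaK G p) ≡ tabulate inj₁ ++ cliques
  verts-coronaK = cong₂ _++_ (map-tabulate (λ i → i) inj₁)
    (cong concat (trans (map-tabulate (λ i → i) (λ v → map (λ i → inj₂ (v , i)) (allFin (p v))))
                        (tabulate-cong (λ v → map-tabulate (λ i → i) (λ i → inj₂ (v , i))))))

  without : Fin n → (Vertex → Bool) → Vertex → Bool
  without u allowed y = allowed y ∧ not (Adj (inj₁ u) y)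

  admissible : ∀ {m} → (Vertex → Bool) → (Fin m → Fin n) → Subset m → Bool
  admissible allowed g []          = true
  admissible allowed g (false ∷ U) = admissible allowed (g ∘ suc) U
  admissible allowed g (true  ∷ U) = allowed (inj₁ (g zero)) ∧ admissible (without (g zero) allowed) (g ∘ suc) U

  remaining : ∀ {m} → (Vertex → Bool) → (Fin m → Fin n) → Subset m → Vertex → Bool
  remaining allowed g []          = allowed
  remaining allowed g (false ∷ U) = remaining allowed (g ∘ suc) U
  remaining allowed g (true  ∷ U) = remaining (without (g zero) allowed) (g ∘ suc) U

  countIndep-hubs : ∀ {m} (g : Fin m → Fin n) allowed k →
    countIndep Adj allowed (tabulate (inj₁ ∘ g) ++ cliques) k
      ≡ ∑[ U ⊆ m ] (𝟙 (admissible allowed g U) * shiftBy ∣ U ∣ (countIndep Adj (remaining allowed g U) cliques) k)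
  countIndep-hubs {zero}  g allowed k       = sym (+-identityʳ _)
  countIndep-hubs {suc m} g allowed zero    = trans (countIndep-hubs (g ∘ suc) allowed zero)
    (sym (trans (cong (∑⊆ m (λ U → 𝟙 (admissible allowed (g ∘ suc) U) * shiftBy ∣ U ∣ (countIndep Adj (remaining allowed (g ∘ suc) U) cliques) 0) +_)
                      (∑⊆-*-zeroʳ {m} (λ U → 𝟙 (admissible allowed g (true ∷ U)))))
                (+-identityʳ _)))
  countIndep-hubs {suc m} g allowed (suc k) =
    cong₂ _+_ (countIndep-hubs (g ∘ suc) allowed (suc k)) (headChosen (allowed (inj₁ (g zero))))
    where
    headChosen : ∀ b →
      (if b then countIndep Adj (without (g zero) allowed) (tabulate (inj₁ ∘ g ∘ suc) ++ cliques) k else 0)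
        ≡ ∑[ U ⊆ m ] (𝟙 (b ∧ admissible (without (g zero) allowed) (g ∘ suc) U)
                       * shiftBy (suc ∣ U ∣) (countIndep Adj (remaining (without (g zero) allowed) (g ∘ suc) U) cliques) (suc k))
    headChosen true  = countIndep-hubs (g ∘ suc) (without (g zero) allowed) k
    headChosen false = sym (∑⊆-zero m)

  allOn : ∀ {m} → (Vertex → Bool) → (Fin m → Fin n) → Subset m → Bool
  allOn allowed g []          = true
  allOn allowed g (false ∷ U) = allOn allowed (g ∘ suc) U
  allOn allowed g (true  ∷ U) = allowed (inj₁ (g zero)) ∧ allOn allowed (g ∘ suc) U

  allOn-true : ∀ {m} (g : Fin m → Fin n) U → allOn (λ _ → true) g U ≡ true
  allOn-true g []          = refl
  allOn-true g (false ∷ U) = allOn-true (g ∘ suc) U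
  allOn-true g (true  ∷ U) = allOn-true (g ∘ suc) U

  allOn-without : ∀ {m} allowed u (g : Fin m → Fin n) U →
    allOn (without u allowed) g U ≡ allOn allowed g U ∧ avoids (λ j → adj G u (g j)) U
  allOn-without allowed u g []          = refl
  allOn-without allowed u g (false ∷ U) = allOn-without allowed u (g ∘ suc) U
  allOn-without allowed u g (true  ∷ U) rewrite allOn-without allowed u (g ∘ suc) U =
    ∧-CS.interchange (allowed (inj₁ (g zero))) (not (adj G u (g zero))) (allOn allowed (g ∘ suc) U) (avoids (λ j → adj G u (g (suc j))) U)

  admissible-allOn : ∀ {m} allowed (g : Fin m → Fin n) U →
    admissible allowed g U ≡ allOn allowed g U ∧ independent (λ i j → adj G (g i) (g j)) U
  admissible-allOn allowed g []          = refl
  admissible-allOn allowed g (false ∷ U) = admissible-allOn allowed (g ∘ suc) U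
  admissible-allOn allowed g (true  ∷ U)
    rewrite admissible-allOn (without (g zero) allowed) (g ∘ suc) U | allOn-without allowed (g zero) (g ∘ suc) U =
    trans (cong (a ∧_) (∧-assoc b c d)) (sym (∧-assoc a b (c ∧ d)))
    where
    a = allowed (inj₁ (g zero))
    b = allOn allowed (g ∘ suc) U
    c = avoids (λ j → adj G (g zero) (g (suc j))) U
    d = independent (λ i j → adj G (g (suc i)) (g (suc j))) U

  remaining-hits : ∀ {m} allowed (g : Fin m → Fin n) U v i →
    remaining allowed g U (inj₂ (v , i)) ≡ allowed (inj₂ (v , i)) ∧ not (hits g U v)
  remaining-hits allowed g []          v i = sym (∧-identityʳ (allowed (inj₂ (v , i))))
  remaining-hits allowed g (false ∷ U) v i = remaining-hits allowed (g ∘ suc) U v i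
  remaining-hits allowed g (true  ∷ U) v i rewrite remaining-hits (without (g zero) allowed) (g ∘ suc) U v i =
    deMorgan (allowed (inj₂ (v , i))) (g zero ==ᶠ v) (hits (g ∘ suc) U v)
    where
    deMorgan : ∀ a b c → (a ∧ not b) ∧ not c ≡ a ∧ not (b ∨ c)
    deMorgan a true  c = trans (cong (_∧ not c) (∧-zeroʳ a)) (sym (∧-zeroʳ a))
    deMorgan a false c = cong (_∧ not c) (∧-identityʳ a)

  clique-adjacent : ∀ v (i j : Fin (p v)) → i ≢ j → Adj (inj₂ (v , i)) (inj₂ (v , j)) ≡ true
  clique-adjacent v i j i≢j rewrite ==ᶠ-refl v with toℕ i ≡ᵇ toℕ j in eq
  ... | true  = contradiction (Finₚ.toℕ-injective (≡ᵇ⇒≡ (toℕ i) (toℕ j) (subst T (sym eq) _))) i≢j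
  ... | false = refl

  countIndep-cliques : ∀ {m} (g : Fin m → Fin n) → (∀ r r′ → g r ≡ g r′ → r ≡ r′) → ∀ (c : Fin n → Bool) allowed →
    (∀ r i → allowed (inj₂ (g r , i)) ≡ c (g r)) → ∀ k →
    countIndep Adj allowed (concat (tabulate (clique ∘ g))) k ≡ esym m (λ r → if c (g r) then p (g r) else 0) k
  countIndep-cliques {zero}  g _     c allowed _    zero    = refl
  countIndep-cliques {zero}  g _     c allowed _    (suc k) = refl
  countIndep-cliques {suc m} g g-inj c allowed allowed≡c zero    =
    trans (countIndep-zero Adj (concat (tabulate (clique ∘ g))) allowed) (sym (esym-zero (suc m) (λ r → if c (g r) then p (g r) else 0)))
  countIndep-cliques {suc m} g g-inj c allowed allowed≡c (suc k) = begin
    countIndep Adj allowed (clique (g zero) ++ R) (suc k)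
      ≡⟨ countIndep-clique Adj (λ i → inj₂ (g zero , i)) R allowed k (clique-adjacent (g zero)) ⟩
    countIndep Adj allowed R (suc k) + ∑[ i < p (g zero) ] (if allowed (inj₂ (g zero , i)) then countIndep Adj (allowed′ i) R k else 0)
      ≡⟨ cong₂ _+_ (countIndep-cliques (g ∘ suc) g′-inj c allowed (allowed≡c ∘ suc) (suc k))
                   (trans (sum-cong-≗ {p (g zero)} (λ i → cong₂ (λ b x → if b then x else 0) (allowed≡c zero i) (rest i)))
                          (∑-if (c (g zero)))) ⟩
    esym m (w ∘ suc) (suc k) + w zero * esym m (w ∘ suc) k
      ≡⟨ esym-suc m w k ⟨
    esym (suc m) w (suc k) ∎
    where
    open ≡-Reasoning
    R : List Vertex
    R = concat (tabulate (clique ∘ g ∘ suc))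
    w : Fin (suc m) → ℕ
    w r = if c (g r) then p (g r) else 0
    allowed′ : Fin (p (g zero)) → Vertex → Bool
    allowed′ i y = allowed y ∧ not (Adj (inj₂ (g zero , i)) y)
    g′-inj : ∀ r r′ → g (suc r) ≡ g (suc r′) → r ≡ r′
    g′-inj r r′ eq = Finₚ.suc-injective (g-inj (suc r) (suc r′) eq)
    rest : ∀ i → countIndep Adj (allowed′ i) R k ≡ esym m (w ∘ suc) k
    rest i = countIndep-cliques (g ∘ suc) g′-inj c (allowed′ i) allowed′≡c k
      where
      allowed′≡c : ∀ r j → allowed′ i (inj₂ (g (suc r) , j)) ≡ c (g (suc r))
      allowed′≡c r j rewrite allowed≡c (suc r) j | ==ᶠ-≢ {u = g zero} {g (suc r)} (λ eq → Finₚ.0≢1+n (g-inj zero (suc r) eq)) =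
        ∧-identityʳ (c (g (suc r)))
    ∑-if : ∀ b → ∑[ i < p (g zero) ] (if b then esym m (w ∘ suc) k else 0)
                   ≡ (if b then p (g zero) else 0) * esym m (w ∘ suc) k
    ∑-if true  = ∑-const (p (g zero)) _
    ∑-if false = trans (∑-const (p (g zero)) 0) (*-zeroʳ (p (g zero)))

  hubSetTerm : ∀ U k →
    𝟙 (admissible (λ _ → true) (λ i → i) U) * shiftBy (∣ U ∣) (countIndep Adj (remaining (λ _ → true) (λ i → i) U) cliques) k
      ≡ 𝟙 (independent (adj G) U) * ∑[ W ⊆ n ] (𝟙 (∣ W ∣ ≡ᵇ k) * extensions p U W)
  hubSetTerm U k = cong₂ _*_
    (cong 𝟙 (trans (admissible-allOn (λ _ → true) (λ i → i) U) (cong (_∧ independent (adj G) U) (allOn-true (λ i → i) U))))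
    (begin
      shiftBy (∣ U ∣) (countIndep Adj (remaining (λ _ → true) (λ i → i) U) cliques) k
        ≡⟨ shiftBy-cong (∣ U ∣) (countIndep-cliques (λ i → i) (λ _ _ eq → eq) (λ v → not (lookup U v)) _ free) k ⟩
      shiftBy (∣ U ∣) (λ k → levelSum n k (monomial (masked p U))) k
        ≡⟨ shiftBy-levelSum (∣ U ∣) (monomial (masked p U)) k ⟩
      ∑[ T ⊆ n ] (𝟙 (∣ U ∣ + ∣ T ∣ ≡ᵇ k) * monomial (masked p U) T)
        ≡⟨ levelSum-extensions p U 0 k ⟩
      ∑[ W ⊆ n ] (𝟙 (∣ W ∣ ≡ᵇ k) * extensions p U W) ∎)
    where
    open ≡-Reasoning
    free : ∀ v i → remaining (λ _ → true) (λ i → i) U (inj₂ (v , i)) ≡ not (lookup U v)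
    free v i = trans (remaining-hits (λ _ → true) (λ i → i) U v i) (cong not (hits-id U v))

  indepCount-coronaK : ∀ k → indepCount (coronaK G p) k ≡ coronaCoeff (adj G) p k
  indepCount-coronaK k = begin
    indepCount (coronaK G p) k
      ≡⟨ cong length (filterᵇ-filterᵇ (independentᵇ Adj) (λ S → length S ≡ᵇ k) (sublists (verts (coronaK G p)))) ⟩
    length (filterᵇ (λ S → independentᵇ Adj S ∧ (length S ≡ᵇ k)) (sublists (verts (coronaK G p))))
      ≡⟨ length-filterᵇ-sublists _ (verts (coronaK G p)) ⟩
    countSublists (λ S → independentᵇ Adj S ∧ (length S ≡ᵇ k)) (verts (coronaK G p))
      ≡⟨ countSublists-cong (verts (coronaK G p)) (λ S →
           cong (λ b → b ∧ (length S ≡ᵇ k)) (sym (trans (cong (independentᵇ Adj S ∧_) (allᵇ-true S)) (∧-identityʳ _)))) ⟩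
    countSublists (isIndepSublist Adj (λ _ → true) k) (verts (coronaK G p))
      ≡⟨ countSublists-isIndepSublist Adj (verts (coronaK G p)) (λ _ → true) k ⟩
    countIndep Adj (λ _ → true) (verts (coronaK G p)) k
      ≡⟨ cong (λ L → countIndep Adj (λ _ → true) L k) verts-coronaK ⟩
    countIndep Adj (λ _ → true) (tabulate inj₁ ++ cliques) k
      ≡⟨ countIndep-hubs (λ i → i) (λ _ → true) k ⟩
    ∑[ U ⊆ n ] (𝟙 (admissible (λ _ → true) (λ i → i) U)
                 * shiftBy ∣ U ∣ (countIndep Adj (remaining (λ _ → true) (λ i → i) U) cliques) k)
      ≡⟨ ∑⊆-cong (λ U → hubSetTerm U k) ⟩
    ∑[ U ⊆ n ] (𝟙 (independent (adj G) U) * ∑[ W ⊆ n ] (𝟙 (∣ W ∣ ≡ᵇ k) * extensions p U W))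
      ≡⟨ ∑⊆-cong (λ U → ∑⊆-*-pull (𝟙 (independent (adj G) U)) (λ W → 𝟙 (∣ W ∣ ≡ᵇ k)) (extensions p U)) ⟨
    ∑[ U ⊆ n ] ∑[ W ⊆ n ] (𝟙 (∣ W ∣ ≡ᵇ k) * (𝟙 (independent (adj G) U) * extensions p U W))
      ≡⟨ ∑⊆-comm (λ U W → 𝟙 (∣ W ∣ ≡ᵇ k) * (𝟙 (independent (adj G) U) * extensions p U W)) ⟩
    ∑[ W ⊆ n ] ∑[ U ⊆ n ] (𝟙 (∣ W ∣ ≡ᵇ k) * (𝟙 (independent (adj G) U) * extensions p U W))
      ≡⟨ ∑⊆-cong (λ W → *-distribˡ-∑⊆ (𝟙 (∣ W ∣ ≡ᵇ k)) (λ U → 𝟙 (independent (adj G) U) * extensions p U W)) ⟨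
    coronaCoeff (adj G) p k ∎
    where open ≡-Reasoning

threshold : ∀ k m q → (2 + k + m) * (2 + k + m) ≤ 4 * (2 + k + m + 1) * q →
  suc q * ((1 + k) * (1 + m)) ≤ q * ((2 + k) * (2 + m))
threshold k m q large = begin
  suc q * ((1 + k) * (1 + m))               ≡⟨ expandˡ q k m ⟩
  q * ((1 + k) * (1 + m)) + (1 + k) * (1 + m) ≤⟨ +-monoʳ-≤ (q * ((1 + k) * (1 + m))) product≤ ⟩
  q * ((1 + k) * (1 + m)) + q * (3 + k + m)   ≡⟨ expandʳ q k m ⟨
  q * ((2 + k) * (2 + m))                   ∎
  where
  open ≤-Reasoning
  expandˡ : ∀ q k m → suc q * ((1 + k) * (1 + m)) ≡ q * ((1 + k) * (1 + m)) + (1 + k) * (1 + m)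
  expandˡ = solve-∀
  expandʳ : ∀ q k m → q * ((2 + k) * (2 + m)) ≡ q * ((1 + k) * (1 + m)) + q * (3 + k + m)
  expandʳ = solve-∀
  amgm4 : 4 * ((1 + k) * (1 + m)) ≤ (2 + k + m) * (2 + k + m)
  amgm4 = subst₂ _≤_ (double (1 + k) (1 + m)) (sumSquare k m) (+-monoʳ-≤ (2 * ((1 + k) * (1 + m))) (amgm (1 + k) (1 + m)))
    where
    double : ∀ a b → 2 * (a * b) + 2 * (a * b) ≡ 4 * (a * b)
    double = solve-∀
    sumSquare : ∀ k m → 2 * ((1 + k) * (1 + m)) + ((1 + k) * (1 + k) + (1 + m) * (1 + m)) ≡ (2 + k + m) * (2 + k + m)
    sumSquare = solve-∀
  product≤ : (1 + k) * (1 + m) ≤ q * (3 + k + m)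
  product≤ = *-cancelˡ-≤ 4 (≤-trans amgm4 (≤-trans large (≤-reflexive (regroup q k m))))
    where
    regroup : ∀ q k m → 4 * (2 + k + m + 1) * q ≡ 4 * (q * (3 + k + m))
    regroup = solve-∀

coronaCoeff-logConcave-within : ∀ k m (E : Fin (2 + k + m) → Fin (2 + k + m) → Bool) (p : Fin (2 + k + m) → ℕ) q →
  (∀ v → 0 < p v) → (∀ v → q ≤ p v) → 0 < q → (2 + k + m) * (2 + k + m) ≤ 4 * (2 + k + m + 1) * q →
  coronaCoeff E p k * coronaCoeff E p (2 + k) ≤ coronaCoeff E p (1 + k) * coronaCoeff E p (1 + k)
coronaCoeff-logConcave-within k m E p q p>0 q≤p q>0 large = *-cancelˡ-≤ (q * c * e₁ * e₁) {{>-nonZero K>0}} (begin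
  q * c * e₁ * e₁ * (s k * s (2 + k))
    ≡⟨ regroupˡ q c e₁ (s k) (s (2 + k)) ⟩
  c * ((e₁ * s k) * (q * (s (2 + k) * e₁)))
    ≤⟨ *-monoʳ-≤ c (*-mono-≤ (esym-coronaCoeff-exchange E p k) (coronaCoeff-esym-exchange E p q (suc k) q≤p)) ⟩
  c * ((esym _ p k * s (1 + k)) * (suc q * (s (1 + k) * esym _ p (2 + k))))
    ≡⟨ regroupᵐ c (esym _ p k) (s (1 + k)) q (esym _ p (2 + k)) ⟩
  suc q * (s (1 + k) * s (1 + k)) * (c * (esym _ p k * esym _ p (2 + k)))
    ≤⟨ *-monoʳ-≤ (suc q * (s (1 + k) * s (1 + k))) (newton-inequality k m p p>0) ⟩
  suc q * (s (1 + k) * s (1 + k)) * (d * (e₁ * e₁))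
    ≡⟨ regroupʳ q (s (1 + k)) d e₁ ⟩
  suc q * d * e₁ * e₁ * (s (1 + k) * s (1 + k))
    ≤⟨ *-monoˡ-≤ (s (1 + k) * s (1 + k)) (*-monoˡ-≤ e₁ (*-monoˡ-≤ e₁ (threshold k m q large))) ⟩
  q * c * e₁ * e₁ * (s (1 + k) * s (1 + k)) ∎)
  where
  open ≤-Reasoning
  s = coronaCoeff E p
  c = (2 + k) * (2 + m)
  d = (1 + k) * (1 + m)
  e₁ = esym _ p (1 + k)
  K>0 : 0 < q * c * e₁ * e₁
  K>0 = *-mono-≤ (*-mono-≤ (*-mono-≤ q>0 (s≤s z≤n)) e₁>0) e₁>0
    where e₁>0 = esym-positive _ p p>0 (1 + k) (s≤s (≤-trans (m≤m+n k m) (n≤1+n _)))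
  regroupˡ : ∀ q c e a b → q * c * e * e * (a * b) ≡ c * ((e * a) * (q * (b * e)))
  regroupˡ = solve-∀
  regroupᵐ : ∀ c x y q z → c * ((x * y) * (suc q * (y * z))) ≡ suc q * (y * y) * (c * (x * z))
  regroupᵐ = solve-∀
  regroupʳ : ∀ q y d e → suc q * (y * y) * (d * (e * e)) ≡ suc q * d * e * e * (y * y)
  regroupʳ = solve-∀

coronaCoeff-logConcave : ∀ n (E : Fin n → Fin n → Bool) (p : Fin n → ℕ) →
  (∀ v → 1 ≤ p v) → (∀ v → n * n ≤ 4 * (n + 1) * p v) →
  ∀ k → coronaCoeff E p k * coronaCoeff E p (2 + k) ≤ coronaCoeff E p (1 + k) * coronaCoeff E p (1 + k)
coronaCoeff-logConcave n E p p>0 large k with 2 + k ≤? n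
... | no  2+k≰n rewrite levelSum-vanishes (2 + k) (touchCount E p) (≰⇒> 2+k≰n) | *-zeroʳ (coronaCoeff E p k) = z≤n
... | yes 2+k≤n with m≤n⇒∃[o]m+o≡n 2+k≤n
...   | m , refl = coronaCoeff-logConcave-within k m E p (p v₀) p>0 v₀-minimal (p>0 v₀) (large v₀)
  where
  v₀ : Fin (2 + k + m)
  v₀ = argmin p zero (allFin _)
  v₀-minimal : ∀ v → p v₀ ≤ p v
  v₀-minimal v = All.lookup (f[argmin]≤f[xs] {f = p} zero (allFin _)) (∈-allFin v)

-- The inequality holds for every k.
corollary3p12 : (n : ℕ) (G : Graph n) (p : Fin n → ℕ)
    → (∀ v → 1 ≤ p v)
    → (∀ v → n * n ≤ 4 * (n + 1) * p v)
    → LogConcave (coronaK G p)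
corollary3p12 n G p p>0 large (suc k) _ _ = begin
  indepCount H k * indepCount H (suc k + 1)
    ≡⟨ cong₂ _*_ (indepCount-coronaK k) (trans (cong (indepCount H) (+-comm (suc k) 1)) (indepCount-coronaK (2 + k))) ⟩
  coronaCoeff (adj G) p k * coronaCoeff (adj G) p (2 + k)
    ≤⟨ coronaCoeff-logConcave n (adj G) p p>0 large k ⟩
  coronaCoeff (adj G) p (1 + k) * coronaCoeff (adj G) p (1 + k)
    ≡⟨ cong₂ _*_ (indepCount-coronaK (suc k)) (indepCount-coronaK (suc k)) ⟨
  indepCount H (suc k) * indepCount H (suc k) ∎
  where
  open ≤-Reasoning
  open CoronaCount G p using (indepCount-coronaK)
  H = coronaK G p
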